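{- Let $\lambda\in\mathbb{Z}$, $\tau\in\mathcal{T}_+$, and $e:=|\mathcal{C}(\tau)|$. (1) If $\lambda\leq0$ then $\mathcal{D}_{\lambda,\tau}$ is an isomorphism. (2) If $\lambda\geq1$ then $\mathrm{im}(\mathcal{D}_{\lambda,\tau})$ has codimension $1$ in $\mathcal{S}^{\mathcal{C}(\tau)}$ and $\ker(\mathcal{D}_{\lambda,\tau})=\mathbb{K}\cdot\mathbf{w}^{(\lambda)}$, where $\mathbf{w}^{(\lambda)}=(w^{(\lambda)}_k(\gamma))\in\mathcal{S}^{\mathcal{C}(\tau)}$ is recursively determined, for each $\gamma\in\mathcal{C}(\tau)$, by $w^{(\lambda)}_k(\gamma)=0$ for $k>\lambda$, $w^{(\lambda)}_\lambda(\gamma)=\gamma^\lambda$, and for $1\le k<\lambda$ \[w^{(\lambda)}_k(\gamma)=\frac{p^\lambda\gamma^k}{1-p^{(\lambda-k)e}}\sum_{j=0}^{e-1}\sum_{s=k+1}^\lambda p^{(\lambda-k)j}\,\mathbb{V}^s_{k,1}\,\gamma^{ -sp^{j+1}}\,w^{(\lambda)}_s\bigl(\gamma^{p^{j+1}}\bigr).\]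
   Context: $\mathbb{K}$ is an algebraically closed field of characteristic zero, $p\geq2$ a fixed integer. Mahler trees are the classes of $\mathbb{K}^\times$ under $\alpha\sim\gamma\iff\alpha^{p^r}=\gamma^{p^s}$ for some $r,s\geq0$. For a Mahler tree $\tau$, $\mathcal{C}(\tau)$ is the set of elements of $\tau$ that are roots of unity of order coprime to $p$; $\mathcal{T}_+$ is the set of trees with $\mathcal{C}(\tau)\neq\emptyset$; then $\mathcal{C}(\tau)=\{\gamma^{p^\ell}:0\le\ell\le e-1\}$ for any $\gamma\in\mathcal{C}(\tau)$ and $\gamma^{p^e}=\gamma$. Let $\mathcal{S}:=\bigoplus_{k\in\mathbb{N}}\mathbb{K}$ and $\mathcal{S}^{\mathcal{C}(\tau)}:=\bigoplus_{\gamma\in\mathcal{C}(\tau)}\mathcal{S}$, elements written $(d_k(\gamma))_{k\in\mathbb{N},\gamma\in\mathcal{C}(\tau)}$. The universal coefficients $\mathbb{V}^s_{k,1}\in\mathbb{Q}$ ($1\le k\le s$) are defined by $(x^{p-1}+\dots+x+1)^{ -s}=\sum_{k=1}^s\mathbb{V}^s_{k,1}(x-1)^{s-k}+O((x-1)^s)$, and the Mahler coefficients are $V^s_{k,1}(\beta):=\mathbb{V}^s_{k,1}\beta^{k-sp}$ for $\beta\in\mathbb{K}^\times$ (equivalently, the coefficient of $(x-\beta)^{ -k}$ in the partial fraction decomposition of $(x^p-\beta^p)^{ -s}$). For $\lambda\in\mathbb{Z}$, the cycle map $\mathcal{D}_{\lambda,\tau}:\mathcal{S}^{\mathcal{C}(\tau)}\to\mathcal{S}^{\mathcal{C}(\tau)}$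 is the $\mathbb{K}$-linear map $(d_k(\gamma))\mapsto\bigl(-d_k(\gamma)+p^\lambda\sum_{s\geq k}V^s_{k,1}(\gamma)d_s(\gamma^p)\bigr)_{k,\gamma}$. -}

module Defs where

open import Level using (_⊔_) renaming (suc to lsuc)
open import Algebra.Bundles using (CommutativeRing)
open import Data.Nat as ℕ using (ℕ; zero; suc; NonZero; _∸_)
open import Data.Nat.DivMod using (_mod_)
open import Data.Nat.Combinatorics using (_C_)
open import Data.Fin using (Fin; toℕ)
open import Data.Integer as ℤ using (ℤ; +_; -[1+_])
open import Data.List using (List; []; _∷_)
open import Data.Product using (∃)
open import Relation.Nullary using (¬_)

module RingOps {c ℓ} (R : CommutativeRing c ℓ) where
  open CommutativeRing R

  fromℕ : ℕ → Carrier
  fromℕ zero    = 0#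
  fromℕ (suc n) = 1# + fromℕ n

  pow : Carrier → ℕ → Carrier
  pow x zero    = 1#
  pow x (suc n) = x * pow x n

  sumTo : ℕ → (ℕ → Carrier) → Carrier
  sumTo zero    f = 0#
  sumTo (suc n) f = sumTo n f + f n

-- Algebraically closed fields of characteristic zero.
-- The inverse is a total function, only specified on nonzero elements.

record ACField c ℓ : Set (lsuc (c ⊔ ℓ)) where
  field
    cring : CommutativeRing c ℓ
  open CommutativeRing cring using (Carrier; _≈_; _*_; _+_; 0#; 1#)
  open RingOps cring
  field
    _⁻¹       : Carrier → Carrier
    inverse   : ∀ x → ¬ (x ≈ 0#) → (x * (x ⁻¹)) ≈ 1#
    charZero  : ∀ n → ¬ (fromℕ (suc n) ≈ 0#)
    algClosed : ∀ (n : ℕ) (a : ℕ → Carrier) →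
                ∃ λ x → (pow x (suc n) + sumTo (suc n) (λ i → a i * pow x i)) ≈ 0#

module Mahler {c ℓ} (F : ACField c ℓ) (p : ℕ) where
  open ACField F public
  open CommutativeRing cring public
  open RingOps cring public

  zpow : Carrier → ℤ → Carrier
  zpow x (+ n)     = pow x n
  zpow x -[1+ n ]  = pow (x ⁻¹) (suc n)

  P : Carrier
  P = fromℕ p

  -- With x = 1 + t, x^{p-1}+...+x+1 = Σ_{i<p} (1+t)^i = Σ_m fco m · t^m
  fco : ℕ → Carrier
  fco m = sumTo p (λ i → fromℕ (i C m))

  -- coefficients of the inverse power series g = f^{-1}
  -- invRev n = [g_{n-1}, ..., g_0]
  conv : ℕ → List Carrier → Carrier
  conv m []       = 0#
  conv m (g ∷ gs) = fco m * g + conv (suc m) gs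

  gnext : ℕ → List Carrier → Carrier
  gnext zero    _    = fco 0 ⁻¹
  gnext (suc n) prev = - ((fco 0 ⁻¹) * conv 1 prev)

  invRev : ℕ → List Carrier
  invRev zero    = []
  invRev (suc n) = gnext n (invRev n) ∷ invRev n

  ginv : ℕ → Carrier
  ginv n = gnext n (invRev n)

  smul : (ℕ → Carrier) → (ℕ → Carrier) → ℕ → Carrier
  smul a b n = sumTo (suc n) (λ i → a i * b (n ∸ i))

  sone : ℕ → Carrier
  sone zero    = 1#
  sone (suc _) = 0#

  spow : ℕ → (ℕ → Carrier) → ℕ → Carrier
  spow zero    a = sone
  spow (suc s) a = smul a (spow s a)

  -- universal coefficient 𝕍^s_{k,1} (image in K of the rational number):
  -- coefficient of (x-1)^{s-k} in (x^{p-1}+...+1)^{-s}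
  𝕍 : ℕ → ℕ → Carrier
  𝕍 s k = spow s ginv (s ∸ k)

  V : ℕ → ℕ → Carrier → Carrier
  V s k β = 𝕍 s k * zpow β ((+ k) ℤ.- (+ (s ℕ.* p)))

  pt : Carrier → ℕ → Carrier
  pt γ i = pow γ (p ℕ.^ i)

  module Cycle (e : ℕ) .{{_ : NonZero e}} (γ : Carrier) where

    -- index of γ_i^{p^j} = γ_{i+j mod e}
    next : Fin e → ℕ → Fin e
    next i j = (toℕ i ℕ.+ j) mod e

    -- elements of S^{C(τ)}: vec i n is the component d_{n+1}(γ_i)
    -- (the index k ∈ {1,2,...} is stored shifted by one), finitely supported.
    record Elt : Set (c ⊔ ℓ) where
      field
        vec   : Fin e → ℕ → Carrier
        bound : ℕ
        supp  : ∀ i n → bound ℕ.≤ n → vec i n ≈ 0#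
    open Elt public

    _≋_ : Elt → Elt → Set ℓ
    x ≋ y = ∀ i n → vec x i n ≈ vec y i n

    -- the cycle map D_{λ,τ}; component (k = n+1, γ_i):
    -- -d_k(γ_i) + p^λ Σ_{s ≥ k} V^s_{k,1}(γ_i) d_s(γ_i^p)
    -- (the sum is finite: terms with s > bound vanish)
    D : ℤ → Elt → Fin e → ℕ → Carrier
    D lam d i n =
      - vec d i n
      + zpow P lam * sumTo (bound d ∸ n)
          (λ j → V (suc (n ℕ.+ j)) (suc n) (pt γ (toℕ i)) * vec d (next i 1) (n ℕ.+ j))

    nth : {A : Set c} → A → List A → ℕ → A
    nth z []       _       = z
    nth z (x ∷ xs) zero    = x
    nth z (x ∷ xs) (suc m) = nth z xs m

    zeroF : Fin e → Carrier
    zeroF _ = 0#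

    module W (l : ℕ) where
      -- ws = [w_{k+1}, ..., w_l]; computes w_k
      wnew : ℕ → List (Fin e → Carrier) → Fin e → Carrier
      wnew k ws i =
        (pow P l * pow (pt γ (toℕ i)) k * ((1# - pow P ((l ∸ k) ℕ.* e)) ⁻¹))
        * sumTo e (λ j → sumTo (l ∸ k) (λ q →
            pow P ((l ∸ k) ℕ.* j) * 𝕍 (suc (k ℕ.+ q)) k
            * zpow (pt γ (toℕ i)) (ℤ.- (+ (suc (k ℕ.+ q) ℕ.* (p ℕ.^ suc j))))
            * nth zeroF ws q (next i (suc j))))

      -- wTab t = [w_{l-t}, ..., w_l]
      wTab : ℕ → List (Fin e → Carrier)
      wTab zero    = (λ i → pow (pt γ (toℕ i)) l) ∷ []
      wTab (suc t) = wnew (l ∸ suc t) (wTab t) ∷ wTab t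

      -- w i n = w^{(l)}_{n+1}(γ_i)  (zero for n+1 > l)
      w : Fin e → ℕ → Carrier
      w i n = nth zeroF (wTab (l ∸ 1)) n i

module Submission where

-- D_{λ,τ} is triangular for the grading by k: the k-th component of D d involves
-- d_k only through the diagonal block x ↦ −x(γ) + p^λ V^k_{k,1}(γ) x(γ^p), and
-- otherwise only the d_s with s > k. Rescaling x(γᵢ) by γᵢ^k turns this block into
-- the cyclic recurrence c ↦ (−cᵢ + p^{λ−k} cᵢ₊₁) on 𝕂^e, which is invertible unless
-- p^{(λ−k)e} = 1, i.e. unless k = λ; for k = λ its kernel consists of the constant
-- vectors and its image misses the constant vector 1. Solving level by level from
-- the top down gives bijectivity for λ ≤ 0. For λ ≥ 1 it shows that γ^λ placed at
-- level λ spans a complement of the image, and that the kernel is spanned by the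
-- vector that is γ^λ at level λ with the lower levels solved for, which is w^{(λ)}.

open import Defs
open import Data.Nat as ℕ using (ℕ; NonZero; _^_)
open import Data.Nat.Coprimality using (Coprime)
open import Data.Integer as ℤ using (ℤ; +_; ∣_∣)
open import Data.Fin using (Fin; toℕ)
open import Data.Product using (Σ; ∃; _×_)
open import Relation.Nullary using (¬_)
open import Relation.Binary.PropositionalEquality using (_≡_; _≢_)
open import Level using (Level)

open import Algebra.Bundles using (CommutativeRing; RawRing)
import Algebra.Solver.Ring as RingSolver
import Algebra.Solver.Ring.AlmostCommutativeRing as ACR
open import Data.Nat using (zero; suc; _≤_; _<_; z≤n; s≤s; _⊔_)
import Data.Nat.Properties as ℕP
open import Data.Nat.DivMod using (_%_; _mod_; _/_; m<n⇒m%n≡m; [m+n]%n≡m%n; %-distribˡ-+; m%n%n≡m%n; m≡m%n+[m/n]*n)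
open import Data.Nat.Combinatorics using (nCk≡nC[n∸k]; nCn≡1)
open import Data.Fin using (fromℕ<)
import Data.Fin.Properties as FinP
open import Data.Integer using (-[1+_]; _⊖_; sign; _◃_)
import Data.Integer.Properties as ℤP
open import Data.Maybe using (Maybe; just; nothing)
open import Data.Sign as Sign using (Sign)
open import Data.Product using (_,_; proj₁; proj₂)
open import Function using (case_of_)
open import Data.Sum using (inj₁; inj₂)
open import Data.Empty using (⊥-elim)
open import Relation.Nullary using (yes; no)
open import Relation.Binary.Definitions using (tri<; tri≈; tri>)
import Relation.Binary.PropositionalEquality as ≡

module RingLemmas {c ℓ} (R : CommutativeRing c ℓ) where
  open CommutativeRing R public
  open RingOps R public
  open import Algebra.Properties.Ring ring public
  open import Relation.Binary.Reasoning.Setoid setoid public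

  fromℕ-+ : ∀ m n → fromℕ (m ℕ.+ n) ≈ fromℕ m + fromℕ n
  fromℕ-+ zero    n = sym (+-identityˡ _)
  fromℕ-+ (suc m) n = trans (+-congˡ (fromℕ-+ m n)) (sym (+-assoc _ _ _))

  fromℕ-* : ∀ m n → fromℕ (m ℕ.* n) ≈ fromℕ m * fromℕ n
  fromℕ-* zero    n = sym (zeroˡ _)
  fromℕ-* (suc m) n = begin
    fromℕ (n ℕ.+ m ℕ.* n)            ≈⟨ fromℕ-+ n (m ℕ.* n) ⟩
    fromℕ n + fromℕ (m ℕ.* n)        ≈⟨ +-congˡ (fromℕ-* m n) ⟩
    fromℕ n + fromℕ m * fromℕ n      ≈⟨ +-congʳ (*-identityˡ _) ⟨
    1# * fromℕ n + fromℕ m * fromℕ n ≈⟨ distribʳ _ _ _ ⟨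
    (1# + fromℕ m) * fromℕ n         ∎

  fromℕ-∸ : ∀ m n → n ≤ m → fromℕ (m ℕ.∸ n) ≈ fromℕ m - fromℕ n
  fromℕ-∸ m n n≤m = begin
    fromℕ (m ℕ.∸ n)                       ≈⟨ +-identityʳ _ ⟨
    fromℕ (m ℕ.∸ n) + 0#                  ≈⟨ +-congˡ (-‿inverseʳ (fromℕ n)) ⟨
    fromℕ (m ℕ.∸ n) + (fromℕ n - fromℕ n) ≈⟨ +-assoc _ _ _ ⟨
    (fromℕ (m ℕ.∸ n) + fromℕ n) - fromℕ n ≈⟨ +-congʳ (fromℕ-+ (m ℕ.∸ n) n) ⟨
    fromℕ (m ℕ.∸ n ℕ.+ n) - fromℕ n       ≡⟨ ≡.cong (λ k → fromℕ k - fromℕ n) (ℕP.m∸n+n≡m n≤m) ⟩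
    fromℕ m - fromℕ n                     ∎

  -- The ring solver needs coefficients with decidable equality, so we
  -- instantiate it with ℤ and its canonical image in R.
  module IntegerCoefficients where
    signed : Sign → Carrier → Carrier
    signed Sign.+ x = x
    signed Sign.- x = - x

    signed-cong : ∀ s {x y} → x ≈ y → signed s x ≈ signed s y
    signed-cong Sign.+ x≈y = x≈y
    signed-cong Sign.- x≈y = -‿cong x≈y

    signed-* : ∀ s t x y → signed (s Sign.* t) (x * y) ≈ signed s x * signed t y
    signed-* Sign.- Sign.- x y = begin
      x * y           ≈⟨ -‿involutive _ ⟨
      - - (x * y)     ≈⟨ -‿cong (-‿distribʳ-* x y) ⟩
      - (x * - y)     ≈⟨ -‿distribˡ-* x (- y) ⟩
      - x * - y       ∎
    signed-* Sign.- Sign.+ x y = -‿distribˡ-* x y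
    signed-* Sign.+ Sign.- x y = -‿distribʳ-* x y
    signed-* Sign.+ Sign.+ x y = refl

    fromℤ : ℤ → Carrier
    fromℤ i = signed (sign i) (fromℕ ∣ i ∣)

    fromℤ-◃ : ∀ s n → fromℤ (s ◃ n) ≈ signed s (fromℕ n)
    fromℤ-◃ Sign.- zero    = sym -0#≈0#
    fromℤ-◃ Sign.+ zero    = refl
    fromℤ-◃ Sign.- (suc n) = refl
    fromℤ-◃ Sign.+ (suc n) = refl

    fromℤ-neg : ∀ i → fromℤ (ℤ.- i) ≈ - fromℤ i
    fromℤ-neg -[1+ n ]  = sym (-‿involutive _)
    fromℤ-neg (+ zero)  = sym -0#≈0#
    fromℤ-neg (+ suc n) = refl

    fromℤ-* : ∀ i j → fromℤ (i ℤ.* j) ≈ fromℤ i * fromℤ j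
    fromℤ-* i j = begin
      fromℤ (i ℤ.* j)                                       ≈⟨ fromℤ-◃ (sign i Sign.* sign j) (∣ i ∣ ℕ.* ∣ j ∣) ⟩
      signed (sign i Sign.* sign j) (fromℕ (∣ i ∣ ℕ.* ∣ j ∣)) ≈⟨ signed-cong (sign i Sign.* sign j) (fromℕ-* ∣ i ∣ ∣ j ∣) ⟩
      signed (sign i Sign.* sign j) (fromℕ ∣ i ∣ * fromℕ ∣ j ∣) ≈⟨ signed-* (sign i) (sign j) _ _ ⟩
      fromℤ i * fromℤ j                                     ∎

    fromℤ-⊖ : ∀ m n → fromℤ (m ⊖ n) ≈ fromℕ m - fromℕ n
    fromℤ-⊖ m n with ℕP.≤-<-connex n m
    ... | inj₁ n≤m = begin
      fromℤ (m ⊖ n)       ≡⟨ ≡.cong fromℤ (ℤP.⊖-≥ n≤m) ⟩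
      fromℕ (m ℕ.∸ n)     ≈⟨ fromℕ-∸ m n n≤m ⟩
      fromℕ m - fromℕ n   ∎
    ... | inj₂ m<n = begin
      fromℤ (m ⊖ n)               ≡⟨ ≡.cong fromℤ (ℤP.⊖-< m<n) ⟩
      fromℤ (ℤ.- (+ (n ℕ.∸ m)))   ≈⟨ fromℤ-neg (+ (n ℕ.∸ m)) ⟩
      - fromℕ (n ℕ.∸ m)           ≈⟨ -‿cong (fromℕ-∸ n m (ℕP.<⇒≤ m<n)) ⟩
      - (fromℕ n - fromℕ m)       ≈⟨ ⁻¹-anti-homo‿- _ _ ⟩
      fromℕ m - fromℕ n           ∎

    fromℤ-+ : ∀ i j → fromℤ (i ℤ.+ j) ≈ fromℤ i + fromℤ j
    fromℤ-+ -[1+ m ] -[1+ n ] = begin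
      - (1# + fromℕ (suc (m ℕ.+ n)))     ≈⟨ -‿cong (+-congˡ (fromℕ-+ (suc m) n)) ⟩
      - (1# + (fromℕ (suc m) + fromℕ n)) ≈⟨ -‿cong (trans (sym (+-assoc _ _ _)) (trans (+-congʳ (+-comm _ _)) (+-assoc _ _ _))) ⟩
      - (fromℕ (suc m) + fromℕ (suc n))  ≈⟨ -‿+-comm _ _ ⟨
      - fromℕ (suc m) + - fromℕ (suc n)  ∎
    fromℤ-+ -[1+ m ] (+ n)    = trans (fromℤ-⊖ n (suc m)) (+-comm _ _)
    fromℤ-+ (+ m)    -[1+ n ] = fromℤ-⊖ m (suc n)
    fromℤ-+ (+ m)    (+ n)    = fromℕ-+ m n

    ℤ-rawRing : RawRing _ _
    ℤ-rawRing = record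
      { Carrier = ℤ ; _≈_ = _≡_ ; _+_ = ℤ._+_ ; _*_ = ℤ._*_ ; -_ = ℤ.-_ ; 0# = + 0 ; 1# = + 1 }

    almostCommutativeRing : ACR.AlmostCommutativeRing c ℓ
    almostCommutativeRing = ACR.fromCommutativeRing R

    fromℤ-homomorphism : ℤ-rawRing ACR.-Raw-AlmostCommutative⟶ almostCommutativeRing
    fromℤ-homomorphism = record
      { ⟦_⟧ = fromℤ ; +-homo = fromℤ-+ ; *-homo = fromℤ-* ; -‿homo = fromℤ-neg
      ; 0-homo = refl ; 1-homo = +-identityʳ _ }

    fromℤ-≟ : ∀ i j → Maybe (fromℤ i ≈ fromℤ j)
    fromℤ-≟ i j with i ℤ.≟ j
    ... | yes ≡.refl = just refl
    ... | no _       = nothing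

  open RingSolver IntegerCoefficients.ℤ-rawRing IntegerCoefficients.almostCommutativeRing
    IntegerCoefficients.fromℤ-homomorphism IntegerCoefficients.fromℤ-≟ public
    using (solve; _:=_; _:+_; _:*_; _:-_; :-_)

  sumTo-cong : ∀ n {f g : ℕ → Carrier} → (∀ j → j < n → f j ≈ g j) → sumTo n f ≈ sumTo n g
  sumTo-cong zero    f≈g = refl
  sumTo-cong (suc n) f≈g = +-cong (sumTo-cong n (λ j j<n → f≈g j (ℕP.m<n⇒m<1+n j<n))) (f≈g n ℕP.≤-refl)

  sumTo-zero : ∀ n {f : ℕ → Carrier} → (∀ j → j < n → f j ≈ 0#) → sumTo n f ≈ 0#
  sumTo-zero zero    f≈0 = refl
  sumTo-zero (suc n) f≈0 =
    trans (+-cong (sumTo-zero n (λ j j<n → f≈0 j (ℕP.m<n⇒m<1+n j<n))) (f≈0 n ℕP.≤-refl)) (+-identityʳ _)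

  sumTo-+ : ∀ n (f g : ℕ → Carrier) → sumTo n (λ j → f j + g j) ≈ sumTo n f + sumTo n g
  sumTo-+ zero    f g = sym (+-identityʳ _)
  sumTo-+ (suc n) f g = trans (+-congʳ (sumTo-+ n f g))
    (solve 4 (λ a b c d → (a :+ b) :+ (c :+ d) := (a :+ c) :+ (b :+ d)) refl _ _ _ _)

  *-distribˡ-sumTo : ∀ n a (f : ℕ → Carrier) → a * sumTo n f ≈ sumTo n (λ j → a * f j)
  *-distribˡ-sumTo zero    a f = zeroʳ _
  *-distribˡ-sumTo (suc n) a f = trans (distribˡ _ _ _) (+-congʳ (*-distribˡ-sumTo n a f))

  sumTo-head : ∀ n (f : ℕ → Carrier) → sumTo (suc n) f ≈ f 0 + sumTo n (λ j → f (suc j))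
  sumTo-head zero    f = trans (+-identityˡ _) (sym (+-identityʳ _))
  sumTo-head (suc n) f = trans (+-congʳ (sumTo-head n f)) (+-assoc _ _ _)

  sumTo-extend : ∀ a b {f : ℕ → Carrier} → a ≤ b → (∀ j → a ≤ j → f j ≈ 0#) → sumTo a f ≈ sumTo b f
  sumTo-extend a zero    z≤n  f≈0 = refl
  sumTo-extend a (suc b) a≤1+b f≈0 with ℕP.m≤n⇒m<n∨m≡n a≤1+b
  ... | inj₁ a<1+b  = trans (sym (+-identityʳ _))
                        (+-cong (sumTo-extend a b (ℕP.≤-pred a<1+b) f≈0) (sym (f≈0 b (ℕP.≤-pred a<1+b))))
  ... | inj₂ ≡.refl = refl

  sumTo-1# : ∀ n → sumTo n (λ _ → 1#) ≈ fromℕ n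
  sumTo-1# zero    = refl
  sumTo-1# (suc n) = trans (+-congʳ (sumTo-1# n)) (+-comm _ _)

  pow-cong : ∀ {x y} n → x ≈ y → pow x n ≈ pow y n
  pow-cong zero    x≈y = refl
  pow-cong (suc n) x≈y = *-cong x≈y (pow-cong n x≈y)

  pow-+ : ∀ x m n → pow x (m ℕ.+ n) ≈ pow x m * pow x n
  pow-+ x zero    n = sym (*-identityˡ _)
  pow-+ x (suc m) n = trans (*-congˡ (pow-+ x m n)) (sym (*-assoc _ _ _))

  pow-* : ∀ x m n → pow x (m ℕ.* n) ≈ pow (pow x m) n
  pow-* x m zero    = ≡.subst (λ k → pow x k ≈ 1#) (≡.sym (ℕP.*-zeroʳ m)) refl
  pow-* x m (suc n) = begin
    pow x (m ℕ.* suc n)       ≡⟨ ≡.cong (pow x) (ℕP.*-suc m n) ⟩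
    pow x (m ℕ.+ m ℕ.* n)     ≈⟨ pow-+ x m (m ℕ.* n) ⟩
    pow x m * pow x (m ℕ.* n) ≈⟨ *-congˡ (pow-* x m n) ⟩
    pow x m * pow (pow x m) n ∎

  pow-distrib-* : ∀ x y n → pow (x * y) n ≈ pow x n * pow y n
  pow-distrib-* x y zero    = sym (*-identityˡ _)
  pow-distrib-* x y (suc n) = trans (*-congˡ (pow-distrib-* x y n))
    (solve 4 (λ a b c d → (a :* b) :* (c :* d) := (a :* c) :* (b :* d)) refl _ _ _ _)

  pow-1# : ∀ n → pow 1# n ≈ 1#
  pow-1# zero    = refl
  pow-1# (suc n) = trans (*-identityˡ _) (pow-1# n)

  fromℕ-^ : ∀ m n → fromℕ (m ℕ.^ n) ≈ pow (fromℕ m) n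
  fromℕ-^ m zero    = +-identityʳ _
  fromℕ-^ m (suc n) = trans (fromℕ-* m (m ℕ.^ n)) (*-congˡ (fromℕ-^ m n))

module FieldLemmas {c ℓ} (F : ACField c ℓ) where
  open ACField F using (cring; _⁻¹; inverse; charZero)
  open RingLemmas cring public

  1#≉0# : ¬ 1# ≈ 0#
  1#≉0# 1≈0 = charZero 0 (trans (+-identityʳ _) 1≈0)

  inverseˡ : ∀ {x} → ¬ x ≈ 0# → x ⁻¹ * x ≈ 1#
  inverseˡ x≉0 = trans (*-comm _ _) (inverse _ x≉0)

  unit⇒≉0 : ∀ {x y} → x * y ≈ 1# → ¬ x ≈ 0#
  unit⇒≉0 {x} {y} xy≈1 x≈0 = 1#≉0# (trans (sym xy≈1) (trans (*-congʳ x≈0) (zeroˡ y)))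

  inverse-unique : ∀ {x y} → x * y ≈ 1# → y ≈ x ⁻¹
  inverse-unique {x} {y} xy≈1 = begin
    y              ≈⟨ *-identityʳ _ ⟨
    y * 1#         ≈⟨ *-congˡ (inverse x (unit⇒≉0 xy≈1)) ⟨
    y * (x * x ⁻¹) ≈⟨ solve 3 (λ a b c → a :* (b :* c) := (b :* a) :* c) refl y x (x ⁻¹) ⟩
    (x * y) * x ⁻¹ ≈⟨ *-congʳ xy≈1 ⟩
    1# * x ⁻¹      ≈⟨ *-identityˡ _ ⟩
    x ⁻¹           ∎

  ⁻¹-cong : ∀ {x y} → x ≈ y → ¬ x ≈ 0# → x ⁻¹ ≈ y ⁻¹
  ⁻¹-cong x≈y x≉0 = inverse-unique (trans (*-congʳ (sym x≈y)) (inverse _ x≉0))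

  *-cancelˡ-≈0 : ∀ {a x} → ¬ a ≈ 0# → a * x ≈ 0# → x ≈ 0#
  *-cancelˡ-≈0 {a} {x} a≉0 ax≈0 = begin
    x              ≈⟨ *-identityˡ _ ⟨
    1# * x         ≈⟨ *-congʳ (inverseˡ a≉0) ⟨
    (a ⁻¹ * a) * x ≈⟨ *-assoc _ _ _ ⟩
    a ⁻¹ * (a * x) ≈⟨ *-congˡ ax≈0 ⟩
    a ⁻¹ * 0#      ≈⟨ zeroʳ _ ⟩
    0#             ∎

  pow-inverse : ∀ {x} n → ¬ x ≈ 0# → pow x n * pow (x ⁻¹) n ≈ 1#
  pow-inverse {x} n x≉0 = trans (sym (pow-distrib-* x (x ⁻¹) n)) (trans (pow-cong n (inverse x x≉0)) (pow-1# n))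

  *-cancelˡ-≈ : ∀ {a x y} → ¬ a ≈ 0# → a * x ≈ a * y → x ≈ y
  *-cancelˡ-≈ {a} {x} {y} a≉0 ax≈ay = x∙y⁻¹≈ε⇒x≈y x y (*-cancelˡ-≈0 a≉0 (begin
    a * (x - y)     ≈⟨ x[y-z]≈xy-xz a x y ⟩
    a * x - a * y   ≈⟨ +-congʳ ax≈ay ⟩
    a * y - a * y   ≈⟨ -‿inverseʳ _ ⟩
    0#              ∎))

  pow-≉0 : ∀ {x} n → ¬ x ≈ 0# → ¬ pow x n ≈ 0#
  pow-≉0 n x≉0 = unit⇒≉0 (pow-inverse n x≉0)

  pow-⁻¹ : ∀ {x} n → ¬ x ≈ 0# → pow (x ⁻¹) n ≈ pow x n ⁻¹
  pow-⁻¹ n x≉0 = inverse-unique (pow-inverse n x≉0)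

  root-of-unity⇒≉0 : ∀ {x} n → n ≢ 0 → pow x n ≈ 1# → ¬ x ≈ 0#
  root-of-unity⇒≉0 zero    n≢0 _    = ⊥-elim (n≢0 ≡.refl)
  root-of-unity⇒≉0 (suc n) _   xⁿ≈1 = unit⇒≉0 xⁿ≈1

  fromℕ-≉0 : ∀ n → n ≢ 0 → ¬ fromℕ n ≈ 0#
  fromℕ-≉0 zero    n≢0 = ⊥-elim (n≢0 ≡.refl)
  fromℕ-≉0 (suc n) _   = charZero n

  fromℕ-injective : ∀ m n → fromℕ m ≈ fromℕ n → m ≡ n
  fromℕ-injective zero    zero    _ = ≡.refl
  fromℕ-injective zero    (suc n) 0≈n+1 = ⊥-elim (charZero n (sym 0≈n+1))
  fromℕ-injective (suc m) zero    m+1≈0 = ⊥-elim (charZero m m+1≈0)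
  fromℕ-injective (suc m) (suc n) m+1≈n+1 = ≡.cong suc (fromℕ-injective m n (+-cancelˡ 1# _ _ m+1≈n+1))

-- `next` coincides definitionally with `Mahler.Cycle.next`.
module CyclicIndex (e : ℕ) .{{_ : NonZero e}} where
  next : Fin e → ℕ → Fin e
  next i j = (toℕ i ℕ.+ j) mod e

  open ≡.≡-Reasoning

  toℕ-next : ∀ i j → toℕ (next i j) ≡ (toℕ i ℕ.+ j) % e
  toℕ-next i j = FinP.toℕ-fromℕ< _

  toℕ%e : ∀ (i : Fin e) → toℕ i % e ≡ toℕ i
  toℕ%e i = m<n⇒m%n≡m (FinP.toℕ<n i)

  next-zero : ∀ i → next i 0 ≡ i
  next-zero i = FinP.toℕ-injective (begin
    toℕ (next i 0)        ≡⟨ toℕ-next i 0 ⟩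
    (toℕ i ℕ.+ 0) % e     ≡⟨ ≡.cong (_% e) (ℕP.+-identityʳ (toℕ i)) ⟩
    toℕ i % e             ≡⟨ toℕ%e i ⟩
    toℕ i                 ∎)

  next-period : ∀ i → next i e ≡ i
  next-period i = FinP.toℕ-injective (≡.trans (toℕ-next i e) (≡.trans ([m+n]%n≡m%n (toℕ i) e) (toℕ%e i)))

  next-next : ∀ i j k → next (next i j) k ≡ next i (j ℕ.+ k)
  next-next i j k = FinP.toℕ-injective (begin
    toℕ (next (next i j) k)                   ≡⟨ toℕ-next (next i j) k ⟩
    (toℕ (next i j) ℕ.+ k) % e                ≡⟨ ≡.cong (λ m → (m ℕ.+ k) % e) (toℕ-next i j) ⟩
    ((toℕ i ℕ.+ j) % e ℕ.+ k) % e             ≡⟨ %-distribˡ-+ ((toℕ i ℕ.+ j) % e) k e ⟩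
    ((toℕ i ℕ.+ j) % e % e ℕ.+ k % e) % e     ≡⟨ ≡.cong (λ m → (m ℕ.+ k % e) % e) (m%n%n≡m%n (toℕ i ℕ.+ j) e) ⟩
    ((toℕ i ℕ.+ j) % e ℕ.+ k % e) % e         ≡⟨ %-distribˡ-+ (toℕ i ℕ.+ j) k e ⟨
    (toℕ i ℕ.+ j ℕ.+ k) % e                   ≡⟨ ≡.cong (_% e) (ℕP.+-assoc (toℕ i) j k) ⟩
    (toℕ i ℕ.+ (j ℕ.+ k)) % e                 ≡⟨ toℕ-next i (j ℕ.+ k) ⟨
    toℕ (next i (j ℕ.+ k))                    ∎)

  next-suc : ∀ i j → next (next i j) 1 ≡ next i (suc j)
  next-suc i j = ≡.trans (next-next i j 1) (≡.cong (next i) (ℕP.+-comm j 1))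

  next-reaches : ∀ i j → next i ((e ℕ.∸ toℕ i) ℕ.+ toℕ j) ≡ j
  next-reaches i j = FinP.toℕ-injective (begin
    toℕ (next i ((e ℕ.∸ toℕ i) ℕ.+ toℕ j))    ≡⟨ toℕ-next i _ ⟩
    (toℕ i ℕ.+ ((e ℕ.∸ toℕ i) ℕ.+ toℕ j)) % e ≡⟨ ≡.cong (_% e) (ℕP.+-assoc (toℕ i) _ _) ⟨
    (toℕ i ℕ.+ (e ℕ.∸ toℕ i) ℕ.+ toℕ j) % e   ≡⟨ ≡.cong (λ m → (m ℕ.+ toℕ j) % e) (ℕP.m+[n∸m]≡n (ℕP.<⇒≤ (FinP.toℕ<n i))) ⟩
    (e ℕ.+ toℕ j) % e                         ≡⟨ ≡.cong (_% e) (ℕP.+-comm e (toℕ j)) ⟩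
    (toℕ j ℕ.+ e) % e                         ≡⟨ [m+n]%n≡m%n (toℕ j) e ⟩
    toℕ j % e                                 ≡⟨ toℕ%e j ⟩
    toℕ j                                     ∎)

module CyclicRecurrence {c ℓ} (F : ACField c ℓ) (e : ℕ) .{{_ : NonZero e}} where
  open ACField F using (_⁻¹)
  open FieldLemmas F
  open CyclicIndex e

  Δ : Carrier → (Fin e → Carrier) → Fin e → Carrier
  Δ r c i = - c i + r * c (next i 1)

  i₀ : Fin e
  i₀ = fromℕ< (ℕ.>-nonZero⁻¹ e)

  shift-invariant⇒constant : ∀ (f : Fin e → Carrier) → (∀ i → f (next i 1) ≈ f i) → ∀ i j → f j ≈ f i
  shift-invariant⇒constant f inv i j = trans (reflexive (≡.cong f (≡.sym (next-reaches i j)))) (go _)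
    where
    go : ∀ m → f (next i m) ≈ f i
    go zero    = reflexive (≡.cong f (next-zero i))
    go (suc m) = trans (reflexive (≡.cong f (≡.sym (next-suc i m)))) (trans (inv (next i m)) (go m))

  sumTo-rotate : ∀ n (g : ℕ → Carrier) → sumTo n (λ j → g (suc j)) + g 0 ≈ sumTo n g + g n
  sumTo-rotate n g = trans (+-comm _ _) (sym (sumTo-head n g))

  orbitSum : Carrier → (Fin e → Carrier) → Fin e → Carrier
  orbitSum r z i = sumTo e (λ j → pow r j * z (next i j))

  Δ-telescope : ∀ r c m i → sumTo m (λ j → pow r j * Δ r c (next i j)) ≈ - c i + pow r m * c (next i m)
  Δ-telescope r c zero i = begin
    0#                    ≈⟨ -‿inverseˡ _ ⟨
    - c i + c i           ≈⟨ +-congˡ (trans (*-identityˡ _) (reflexive (≡.cong c (next-zero i)))) ⟨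
    - c i + 1# * c (next i 0) ∎
  Δ-telescope r c (suc m) i = begin
    sumTo m (λ j → pow r j * Δ r c (next i j)) + pow r m * Δ r c (next i m)
      ≈⟨ +-congʳ (Δ-telescope r c m i) ⟩
    (- c i + pow r m * c (next i m)) + pow r m * (- c (next i m) + r * c (next (next i m) 1))
      ≈⟨ solve 5 (λ a b x y ρ → (:- a :+ b :* x) :+ b :* (:- x :+ ρ :* y) := :- a :+ (ρ :* b) :* y)
           refl (c i) (pow r m) (c (next i m)) (c (next (next i m) 1)) r ⟩
    - c i + (r * pow r m) * c (next (next i m) 1)
      ≈⟨ +-congˡ (*-congˡ (reflexive (≡.cong c (next-suc i m)))) ⟩
    - c i + pow r (suc m) * c (next i (suc m)) ∎

  -- Comparing orbitSum at i and at next i 1 the terms shift by one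
  -- place, and only the wrap-around term r^e z_i does not cancel.
  orbitSum-shift : ∀ r z i → orbitSum r z i - r * orbitSum r z (next i 1) ≈ (1# - pow r e) * z i
  orbitSum-shift r z i = begin
    A - r * orbitSum r z (next i 1)        ≈⟨ +-congˡ (-‿cong (trans (*-distribˡ-sumTo e r _) (sumTo-cong e (λ j _ →
                                                trans (sym (*-assoc _ _ _)) (*-congˡ (reflexive (≡.cong z (next-next i 1 j)))))))) ⟩
    A - B                                  ≈⟨ solve 4 (λ a b q x → a :- b := ((a :+ q) :- q) :- b) refl A B (pow r e * z i) (z i) ⟩
    ((A + pow r e * z i) - pow r e * z i) - B ≈⟨ +-congʳ (+-congʳ wrap) ⟩
    ((B + z i) - pow r e * z i) - B        ≈⟨ solve 3 (λ b x q → ((b :+ x) :- q) :- b := x :- q) refl B (z i) (pow r e * z i) ⟩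
    z i - pow r e * z i                    ≈⟨ +-congʳ (*-identityˡ _) ⟨
    1# * z i - pow r e * z i               ≈⟨ [y-z]x≈yx-zx (z i) 1# (pow r e) ⟨
    (1# - pow r e) * z i                   ∎
    where
    g : ℕ → Carrier
    g j = pow r j * z (next i j)
    A = sumTo e g
    B = sumTo e (λ j → g (suc j))
    wrap : A + pow r e * z i ≈ B + z i
    wrap = begin
      A + pow r e * z i  ≈⟨ +-congˡ (*-congˡ (reflexive (≡.cong z (next-period i)))) ⟨
      A + g e            ≈⟨ sumTo-rotate e g ⟨
      B + g 0            ≈⟨ +-congˡ (trans (*-identityˡ _) (reflexive (≡.cong z (next-zero i)))) ⟩
      B + z i            ∎

  Δ⁻¹ : Carrier → (Fin e → Carrier) → Fin e → Carrier
  Δ⁻¹ r z i = - ((1# - pow r e) ⁻¹) * orbitSum r z i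

  Δ-Δ⁻¹ : ∀ r z → ¬ (1# - pow r e) ≈ 0# → ∀ i → Δ r (Δ⁻¹ r z) i ≈ z i
  Δ-Δ⁻¹ r z 1-rᵉ≉0 i = begin
    - (- u * A) + r * (- u * A′) ≈⟨ solve 4 (λ u a ρ a′ → :- (:- u :* a) :+ ρ :* (:- u :* a′) := u :* (a :- ρ :* a′)) refl u A r A′ ⟩
    u * (A - r * A′)             ≈⟨ *-congˡ (orbitSum-shift r z i) ⟩
    u * ((1# - pow r e) * z i)   ≈⟨ *-assoc _ _ _ ⟨
    (u * (1# - pow r e)) * z i   ≈⟨ *-congʳ (inverseˡ 1-rᵉ≉0) ⟩
    1# * z i                     ≈⟨ *-identityˡ _ ⟩
    z i                          ∎
    where
    u  = (1# - pow r e) ⁻¹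
    A  = orbitSum r z i
    A′ = orbitSum r z (next i 1)

  Δ-injective : ∀ r c → ¬ (1# - pow r e) ≈ 0# → (∀ i → Δ r c i ≈ 0#) → ∀ i → c i ≈ 0#
  Δ-injective r c 1-rᵉ≉0 Δc≈0 i = *-cancelˡ-≈0 1-rᵉ≉0 (begin
    (1# - pow r e) * c i                         ≈⟨ [y-z]x≈yx-zx (c i) 1# (pow r e) ⟩
    1# * c i - pow r e * c i                     ≈⟨ +-congʳ (*-identityˡ _) ⟩
    c i - pow r e * c i                          ≈⟨ solve 2 (λ x y → x :- y := :- (:- x :+ y)) refl (c i) _ ⟩
    - (- c i + pow r e * c i)                    ≈⟨ -‿cong (+-congˡ (*-congˡ (reflexive (≡.cong c (next-period i))))) ⟨
    - (- c i + pow r e * c (next i e))           ≈⟨ -‿cong (Δ-telescope r c e i) ⟨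
    - sumTo e (λ j → pow r j * Δ r c (next i j)) ≈⟨ -‿cong (sumTo-zero e (λ j _ → trans (*-congˡ (Δc≈0 _)) (zeroʳ _))) ⟩
    - 0#                                         ≈⟨ -0#≈0# ⟩
    0#                                           ∎)

  e≉0 : ¬ fromℕ e ≈ 0#
  e≉0 = fromℕ-≉0 e (λ e≡0 → ℕP.<⇒≢ (ℕ.>-nonZero⁻¹ e) (≡.sym e≡0))

  orbitSum-Δ₁ : ∀ c i → orbitSum 1# (Δ 1# c) i ≈ 0#
  orbitSum-Δ₁ c i = begin
    orbitSum 1# (Δ 1# c) i       ≈⟨ Δ-telescope 1# c e i ⟩
    - c i + pow 1# e * c (next i e) ≈⟨ +-congˡ (trans (*-cong (pow-1# e) (reflexive (≡.cong c (next-period i)))) (*-identityˡ _)) ⟩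
    - c i + c i                  ≈⟨ -‿inverseˡ _ ⟩
    0#                           ∎

  1∉image-Δ₁ : ∀ c → ¬ (∀ i → Δ 1# c i ≈ 1#)
  1∉image-Δ₁ c Δc≈1 = e≉0 (begin
    fromℕ e                    ≈⟨ sumTo-1# e ⟨
    sumTo e (λ _ → 1#)         ≈⟨ sumTo-cong e (λ j _ → trans (*-cong (pow-1# j) (Δc≈1 _)) (*-identityˡ _)) ⟨
    orbitSum 1# (Δ 1# c) i₀    ≈⟨ orbitSum-Δ₁ c i₀ ⟩
    0#                         ∎)

  Δ₁-kernel : ∀ c → (∀ i → Δ 1# c i ≈ 0#) → ∀ i → c i ≈ c i₀
  Δ₁-kernel c Δc≈0 = shift-invariant⇒constant c (λ i → begin
    c (next i 1)                 ≈⟨ +-identityˡ _ ⟨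
    0# + c (next i 1)            ≈⟨ +-congʳ (-‿inverseʳ (c i)) ⟨
    (c i - c i) + c (next i 1)   ≈⟨ +-assoc _ _ _ ⟩
    c i + (- c i + c (next i 1)) ≈⟨ +-congˡ (trans (+-congˡ (sym (*-identityˡ _))) (Δc≈0 i)) ⟩
    c i + 0#                     ≈⟨ +-identityʳ _ ⟩
    c i                          ∎) i₀

  weightedOrbitSum : (Fin e → Carrier) → Fin e → Carrier
  weightedOrbitSum z i = sumTo e (λ j → fromℕ j * z (next i j))

  orbitSum₁-shift-invariant : ∀ z i → orbitSum 1# z (next i 1) ≈ orbitSum 1# z i
  orbitSum₁-shift-invariant z i = sym (x∙y⁻¹≈ε⇒x≈y _ _ (begin
    orbitSum 1# z i - orbitSum 1# z (next i 1)      ≈⟨ +-congˡ (-‿cong (*-identityˡ _)) ⟨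
    orbitSum 1# z i - 1# * orbitSum 1# z (next i 1) ≈⟨ orbitSum-shift 1# z i ⟩
    (1# - pow 1# e) * z i                           ≈⟨ *-congʳ (trans (+-congˡ (-‿cong (pow-1# e))) (-‿inverseʳ 1#)) ⟩
    0# * z i                                        ≈⟨ zeroˡ _ ⟩
    0#                                              ∎))

  weightedOrbitSum-shift : ∀ z i →
    orbitSum 1# z (next i 1) + weightedOrbitSum z (next i 1) ≈ weightedOrbitSum z i + fromℕ e * z i
  weightedOrbitSum-shift z i = begin
    orbitSum 1# z (next i 1) + weightedOrbitSum z (next i 1)
      ≈⟨ sumTo-+ e _ _ ⟨
    sumTo e (λ j → pow 1# j * z (next (next i 1) j) + fromℕ j * z (next (next i 1) j))
      ≈⟨ sumTo-cong e (λ j _ → begin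
           pow 1# j * z (next (next i 1) j) + fromℕ j * z (next (next i 1) j)
             ≈⟨ +-congʳ (*-congʳ (pow-1# j)) ⟩
           1# * z (next (next i 1) j) + fromℕ j * z (next (next i 1) j)
             ≈⟨ distribʳ _ _ _ ⟨
           (1# + fromℕ j) * z (next (next i 1) j)
             ≈⟨ *-congˡ (reflexive (≡.cong z (next-next i 1 j))) ⟩
           g (suc j) ∎) ⟩
    sumTo e (λ j → g (suc j))            ≈⟨ +-identityʳ _ ⟨
    sumTo e (λ j → g (suc j)) + 0#       ≈⟨ +-congˡ (zeroˡ _) ⟨
    sumTo e (λ j → g (suc j)) + g 0      ≈⟨ sumTo-rotate e g ⟩
    weightedOrbitSum z i + g e           ≈⟨ +-congˡ (*-congˡ (reflexive (≡.cong z (next-period i)))) ⟩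
    weightedOrbitSum z i + fromℕ e * z i ∎
    where
    g : ℕ → Carrier
    g j = fromℕ j * z (next i j)

  mean : (Fin e → Carrier) → Carrier
  mean z = fromℕ e ⁻¹ * orbitSum 1# z i₀

  Δ₁-section : (Fin e → Carrier) → Fin e → Carrier
  Δ₁-section z i = fromℕ e ⁻¹ * weightedOrbitSum z i

  Δ₁-section-correct : ∀ z i → Δ 1# (Δ₁-section z) i + mean z ≈ z i
  Δ₁-section-correct z i = begin
    - (u * W i) + 1# * (u * W (next i 1)) + u * T i₀
      ≈⟨ solve 5 (λ u a b t o → :- (u :* a) :+ o :* (u :* b) :+ u :* t := u :* ((t :+ o :* b) :- a) :+ (o :- o) :* b)
           refl u (W i) (W (next i 1)) (T i₀) 1# ⟩
    u * ((T i₀ + 1# * W (next i 1)) - W i) + (1# - 1#) * W (next i 1)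
      ≈⟨ trans (+-congˡ (trans (*-congʳ (-‿inverseʳ 1#)) (zeroˡ _))) (+-identityʳ _) ⟩
    u * ((T i₀ + 1# * W (next i 1)) - W i)
      ≈⟨ *-congˡ (+-congʳ (+-cong (shift-invariant⇒constant T (orbitSum₁-shift-invariant z) (next i 1) i₀) (*-identityˡ _))) ⟩
    u * ((T (next i 1) + W (next i 1)) - W i) ≈⟨ *-congˡ (+-congʳ (weightedOrbitSum-shift z i)) ⟩
    u * ((W i + fromℕ e * z i) - W i)       ≈⟨ *-congˡ (solve 2 (λ a b → (a :+ b) :- a := b) refl (W i) (fromℕ e * z i)) ⟩
    u * (fromℕ e * z i)                     ≈⟨ *-assoc _ _ _ ⟨
    (u * fromℕ e) * z i                     ≈⟨ *-congʳ (inverseˡ e≉0) ⟩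
    1# * z i                                ≈⟨ *-identityˡ _ ⟩
    z i                                     ∎
    where
    u = fromℕ e ⁻¹
    W = weightedOrbitSum z
    T = orbitSum 1# z

^-injectiveʳ : ∀ {p} → 2 ≤ p → ∀ m n → p ^ m ≡ p ^ n → m ≡ n
^-injectiveʳ {p} 2≤p m n pᵐ≡pⁿ with ℕP.<-cmp m n
... | tri< m<n _ _ = ⊥-elim (ℕP.<⇒≢ (ℕP.^-monoʳ-< p 2≤p m<n) pᵐ≡pⁿ)
... | tri≈ _ m≡n _ = m≡n
... | tri> _ _ n<m = ⊥-elim (ℕP.<⇒≢ (ℕP.^-monoʳ-< p 2≤p n<m) (≡.sym pᵐ≡pⁿ))

module MahlerLemmas {c ℓ} (F : ACField c ℓ) (p : ℕ) (2≤p : 2 ≤ p) where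
  open FieldLemmas F public
  open Mahler F p using (_⁻¹; P; zpow; fco; ginv; spow; 𝕍)

  P≉0 : ¬ P ≈ 0#
  P≉0 = fromℕ-≉0 p (λ p≡0 → ℕP.<⇒≢ (ℕP.<-trans (s≤s z≤n) 2≤p) (≡.sym p≡0))

  P^m*P⁻¹^n≈1⇒m≡n : ∀ m n → pow P m * pow (P ⁻¹) n ≈ 1# → m ≡ n
  P^m*P⁻¹^n≈1⇒m≡n m n Pᵐ⁻ⁿ≈1 = ^-injectiveʳ 2≤p m n (fromℕ-injective _ _ (begin
    fromℕ (p ^ m)                           ≈⟨ fromℕ-^ p m ⟩
    pow P m                                 ≈⟨ *-identityʳ _ ⟨
    pow P m * 1#                            ≈⟨ *-congˡ (trans (*-comm _ _) (pow-inverse n P≉0)) ⟨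
    pow P m * (pow (P ⁻¹) n * pow P n)      ≈⟨ *-assoc _ _ _ ⟨
    (pow P m * pow (P ⁻¹) n) * pow P n      ≈⟨ trans (*-congʳ Pᵐ⁻ⁿ≈1) (*-identityˡ _) ⟩
    pow P n                                 ≈⟨ fromℕ-^ p n ⟨
    fromℕ (p ^ n)                           ∎))

  zpow-neg : ∀ β n → zpow β (ℤ.- (+ n)) ≈ pow (β ⁻¹) n
  zpow-neg β zero    = refl
  zpow-neg β (suc n) = refl

  zpow-⊖ : ∀ β m n → ¬ β ≈ 0# → zpow β (m ⊖ n) ≈ pow β m * pow (β ⁻¹) n
  zpow-⊖ β m n β≉0 with ℕP.≤-<-connex n m
  ... | inj₁ n≤m = begin
    zpow β (m ⊖ n)                                   ≡⟨ ≡.cong (zpow β) (ℤP.⊖-≥ n≤m) ⟩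
    pow β (m ℕ.∸ n)                                  ≈⟨ *-identityʳ _ ⟨
    pow β (m ℕ.∸ n) * 1#                             ≈⟨ *-congˡ (pow-inverse n β≉0) ⟨
    pow β (m ℕ.∸ n) * (pow β n * pow (β ⁻¹) n)       ≈⟨ *-assoc _ _ _ ⟨
    (pow β (m ℕ.∸ n) * pow β n) * pow (β ⁻¹) n       ≈⟨ *-congʳ (pow-+ β (m ℕ.∸ n) n) ⟨
    pow β (m ℕ.∸ n ℕ.+ n) * pow (β ⁻¹) n             ≡⟨ ≡.cong (λ k → pow β k * pow (β ⁻¹) n) (ℕP.m∸n+n≡m n≤m) ⟩
    pow β m * pow (β ⁻¹) n                           ∎
  ... | inj₂ m<n = begin
    zpow β (m ⊖ n)                                   ≡⟨ ≡.cong (zpow β) (ℤP.⊖-< m<n) ⟩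
    zpow β (ℤ.- (+ (n ℕ.∸ m)))                       ≈⟨ zpow-neg β (n ℕ.∸ m) ⟩
    pow (β ⁻¹) (n ℕ.∸ m)                             ≈⟨ *-identityˡ _ ⟨
    1# * pow (β ⁻¹) (n ℕ.∸ m)                        ≈⟨ *-congʳ (pow-inverse m β≉0) ⟨
    (pow β m * pow (β ⁻¹) m) * pow (β ⁻¹) (n ℕ.∸ m)  ≈⟨ *-assoc _ _ _ ⟩
    pow β m * (pow (β ⁻¹) m * pow (β ⁻¹) (n ℕ.∸ m))  ≈⟨ *-congˡ (pow-+ (β ⁻¹) m (n ℕ.∸ m)) ⟨
    pow β m * pow (β ⁻¹) (m ℕ.+ (n ℕ.∸ m))           ≡⟨ ≡.cong (λ k → pow β m * pow (β ⁻¹) k) (ℕP.m+[n∸m]≡n (ℕP.<⇒≤ m<n)) ⟩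
    pow β m * pow (β ⁻¹) n                           ∎

  zpow-+- : ∀ β m n → ¬ β ≈ 0# → zpow β (+ m ℤ.- + n) ≈ pow β m * pow (β ⁻¹) n
  zpow-+- β m zero    β≉0 = trans (reflexive (≡.cong (pow β) (ℕP.+-identityʳ m))) (sym (*-identityʳ _))
  zpow-+- β m (suc n) β≉0 = zpow-⊖ β m (suc n) β≉0

  P^[μ-k]e≉1 : ∀ e .{{_ : NonZero e}} μ k → μ ≢ + k → ¬ pow (zpow P μ * pow (P ⁻¹) k) e ≈ 1#
  P^[μ-k]e≉1 e (+ l) k l≢k Pᵉ⁽ˡ⁻ᵏ⁾≈1 = l≢k (≡.cong +_ (ℕP.*-cancelʳ-≡ l k e (P^m*P⁻¹^n≈1⇒m≡n (l ℕ.* e) (k ℕ.* e) (begin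
    pow P (l ℕ.* e) * pow (P ⁻¹) (k ℕ.* e)       ≈⟨ *-cong (pow-* P l e) (pow-* (P ⁻¹) k e) ⟩
    pow (pow P l) e * pow (pow (P ⁻¹) k) e       ≈⟨ pow-distrib-* _ _ e ⟨
    pow (pow P l * pow (P ⁻¹) k) e               ≈⟨ Pᵉ⁽ˡ⁻ᵏ⁾≈1 ⟩
    1#                                           ∎))))
  P^[μ-k]e≉1 e -[1+ m ] k _ Pᵉ⁽ᵐ⁻ᵏ⁾≈1 = ℕP.1+n≢0 (ℕP.m*n≡0⇒m≡0 (suc m ℕ.+ k) e (≡.sym (P^m*P⁻¹^n≈1⇒m≡n 0 ((suc m ℕ.+ k) ℕ.* e) (begin
    1# * pow (P ⁻¹) ((suc m ℕ.+ k) ℕ.* e)          ≈⟨ *-identityˡ _ ⟩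
    pow (P ⁻¹) ((suc m ℕ.+ k) ℕ.* e)               ≈⟨ pow-* (P ⁻¹) (suc m ℕ.+ k) e ⟩
    pow (pow (P ⁻¹) (suc m ℕ.+ k)) e               ≈⟨ pow-cong e (pow-+ (P ⁻¹) (suc m) k) ⟩
    pow (pow (P ⁻¹) (suc m) * pow (P ⁻¹) k) e      ≈⟨ Pᵉ⁽ᵐ⁻ᵏ⁾≈1 ⟩
    1#                                             ∎))))

  spow-0 : ∀ s a → spow s a 0 ≈ pow (a 0) s
  spow-0 zero    a = refl
  spow-0 (suc s) a = trans (+-identityˡ _) (*-congˡ (spow-0 s a))

  fco-0 : fco 0 ≈ P
  fco-0 = trans (sumTo-cong p (λ j _ → trans (reflexive (≡.cong fromℕ (≡.trans (nCk≡nC[n∸k] {0} {j} z≤n) (nCn≡1 j)))) (+-identityʳ _)))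
               (sumTo-1# p)

  -- 𝕍^k_{k,1} is the value of (x^{p-1}+⋯+1)^{-k} at x = 1.
  𝕍-diagonal : ∀ k → 𝕍 k k ≈ pow (P ⁻¹) k
  𝕍-diagonal k = begin
    spow k ginv (k ℕ.∸ k) ≡⟨ ≡.cong (spow k ginv) (ℕP.n∸n≡0 k) ⟩
    spow k ginv 0         ≈⟨ spow-0 k ginv ⟩
    pow (ginv 0) k        ≈⟨ pow-cong k (⁻¹-cong fco-0 (λ fco0≈0 → P≉0 (trans (sym fco-0) fco0≈0))) ⟩
    pow (P ⁻¹) k          ∎

module DiagonalBlock {c ℓ} (F : ACField c ℓ) (p : ℕ) (2≤p : 2 ≤ p) (e : ℕ) .{{_ : NonZero e}}
  (γ : Mahler.Carrier F p) (γ≉0 : ¬ Mahler._≈_ F p γ (Mahler.0# F p))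
  (γ-periodic : Mahler._≈_ F p (Mahler.pow F p γ (p ^ e)) γ) (lam : ℤ) where
  open MahlerLemmas F p 2≤p public
  open Mahler F p using (_⁻¹; P; zpow; V; pt)
  open CyclicIndex e public
  open CyclicRecurrence F e public

  γᵢ : Fin e → Carrier
  γᵢ i = pt γ (toℕ i)

  pt-periodic : ∀ q a → pow γ (p ^ (a ℕ.+ q ℕ.* e)) ≈ pow γ (p ^ a)
  pt-periodic zero    a = reflexive (≡.cong (λ k → pow γ (p ^ k)) (ℕP.+-identityʳ a))
  pt-periodic (suc q) a = begin
    pow γ (p ^ (a ℕ.+ (e ℕ.+ q ℕ.* e)))      ≡⟨ ≡.cong (λ k → pow γ (p ^ k)) (ℕP.+-assoc a e (q ℕ.* e)) ⟨
    pow γ (p ^ (a ℕ.+ e ℕ.+ q ℕ.* e))        ≈⟨ pt-periodic q (a ℕ.+ e) ⟩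
    pow γ (p ^ (a ℕ.+ e))                    ≡⟨ ≡.cong (pow γ) (≡.trans (ℕP.^-distribˡ-+-* p a e) (ℕP.*-comm (p ^ a) (p ^ e))) ⟩
    pow γ (p ^ e ℕ.* p ^ a)                  ≈⟨ pow-* γ (p ^ e) (p ^ a) ⟩
    pow (pow γ (p ^ e)) (p ^ a)              ≈⟨ pow-cong (p ^ a) γ-periodic ⟩
    pow γ (p ^ a)                            ∎

  γᵢ-next : ∀ i j → γᵢ (next i j) ≈ pow (γᵢ i) (p ^ j)
  γᵢ-next i j = begin
    pow γ (p ^ toℕ (next i j))                      ≡⟨ ≡.cong (λ k → pow γ (p ^ k)) (toℕ-next i j) ⟩
    pow γ (p ^ (m % e))                             ≈⟨ pt-periodic (m / e) (m % e) ⟨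
    pow γ (p ^ (m % e ℕ.+ (m / e) ℕ.* e))           ≡⟨ ≡.cong (λ k → pow γ (p ^ k)) (m≡m%n+[m/n]*n m e) ⟨
    pow γ (p ^ m)                                   ≡⟨ ≡.cong (pow γ) (ℕP.^-distribˡ-+-* p (toℕ i) j) ⟩
    pow γ (p ^ toℕ i ℕ.* p ^ j)                     ≈⟨ pow-* γ (p ^ toℕ i) (p ^ j) ⟩
    pow (γᵢ i) (p ^ j)                              ∎
    where m = toℕ i ℕ.+ j

  γᵢ≉0 : ∀ i → ¬ γᵢ i ≈ 0#
  γᵢ≉0 i = pow-≉0 (p ^ toℕ i) γ≉0

  zpow-γᵢ-next : ∀ N i j → zpow (γᵢ i) (ℤ.- (+ (N ℕ.* p ^ suc j))) ≈ pow (γᵢ (next i j) ⁻¹) (N ℕ.* p)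
  zpow-γᵢ-next N i j = begin
    zpow (γᵢ i) (ℤ.- (+ (N ℕ.* p ^ suc j)))      ≈⟨ zpow-neg (γᵢ i) (N ℕ.* p ^ suc j) ⟩
    pow (γᵢ i ⁻¹) (N ℕ.* p ^ suc j)              ≡⟨ ≡.cong (pow (γᵢ i ⁻¹)) (≡.trans (≡.sym (ℕP.*-assoc N p (p ^ j))) (ℕP.*-comm (N ℕ.* p) (p ^ j))) ⟩
    pow (γᵢ i ⁻¹) (p ^ j ℕ.* (N ℕ.* p))          ≈⟨ pow-* (γᵢ i ⁻¹) (p ^ j) (N ℕ.* p) ⟩
    pow (pow (γᵢ i ⁻¹) (p ^ j)) (N ℕ.* p)        ≈⟨ pow-cong (N ℕ.* p) (pow-⁻¹ (p ^ j) (γᵢ≉0 i)) ⟩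
    pow (pow (γᵢ i) (p ^ j) ⁻¹) (N ℕ.* p)        ≈⟨ pow-cong (N ℕ.* p) (⁻¹-cong (sym (γᵢ-next i j)) (pow-≉0 (p ^ j) (γᵢ≉0 i))) ⟩
    pow (γᵢ (next i j) ⁻¹) (N ℕ.* p)             ∎

  scale : ℕ → Fin e → Carrier
  scale k i = pow (γᵢ i) k

  unscale : ℕ → Fin e → Carrier
  unscale k i = pow (γᵢ i ⁻¹) k

  scale≉0 : ∀ k i → ¬ scale k i ≈ 0#
  scale≉0 k i = pow-≉0 k (γᵢ≉0 i)

  scale-unscale : ∀ k (x : Fin e → Carrier) i → x i ≈ scale k i * (unscale k i * x i)
  scale-unscale k x i = sym (trans (sym (*-assoc _ _ _)) (trans (*-congʳ (pow-inverse k (γᵢ≉0 i))) (*-identityˡ _)))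

  Pλ : Carrier
  Pλ = zpow P lam

  ρ : ℕ → Carrier
  ρ k = Pλ * pow (P ⁻¹) k

  -- The diagonal block of D at level k = n + 1 (components are stored shifted by one).
  diag : ℕ → (Fin e → Carrier) → Fin e → Carrier
  diag n x i = - x i + Pλ * (V (suc n) (suc n) (γᵢ i) * x (next i 1))

  diag-cong : ∀ n {x y : Fin e → Carrier} → (∀ i → x i ≈ y i) → ∀ i → diag n x i ≈ diag n y i
  diag-cong n x≈y i = +-cong (-‿cong (x≈y i)) (*-congˡ (*-congˡ (x≈y _)))

  -- V^k_{k,1}(γᵢ) = p^{-k} γᵢ^{k-kp} while γᵢ₊₁^k = γᵢ^{kp}.
  diag-scale : ∀ n (c : Fin e → Carrier) i → diag n (λ j → scale (suc n) j * c j) i ≈ scale (suc n) i * Δ (ρ (suc n)) c i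
  diag-scale n c i = begin
    - (γᵏ * c i) + Pλ * (V k k β * (scale k (next i 1) * c (next i 1)))
      ≈⟨ +-congˡ (*-congˡ (*-cong (*-congʳ (𝕍-diagonal k)) (*-congʳ (pow-cong k (γᵢ-next i 1))))) ⟩
    - (γᵏ * c i) + Pλ * ((pow (P ⁻¹) k * zpow β (+ k ℤ.- + (k ℕ.* p))) * (pow (pow β (p ^ 1)) k * c (next i 1)))
      ≈⟨ +-congˡ (*-congˡ (*-cong (*-congˡ (zpow-+- β k (k ℕ.* p) (γᵢ≉0 i))) (*-congʳ βᵖᵏ≈βᵏᵖ))) ⟩
    - (γᵏ * c i) + Pλ * ((pow (P ⁻¹) k * (γᵏ * pow (β ⁻¹) (k ℕ.* p))) * (pow β (k ℕ.* p) * c (next i 1)))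
      ≈⟨ solve 7 (λ g x r q b b′ y → :- (g :* x) :+ r :* ((q :* (g :* b′)) :* (b :* y)) := :- (g :* x) :+ (g :* ((r :* q) :* y)) :* (b′ :* b))
           refl γᵏ (c i) Pλ (pow (P ⁻¹) k) (pow β (k ℕ.* p)) (pow (β ⁻¹) (k ℕ.* p)) (c (next i 1)) ⟩
    - (γᵏ * c i) + (γᵏ * (ρ k * c (next i 1))) * (pow (β ⁻¹) (k ℕ.* p) * pow β (k ℕ.* p))
      ≈⟨ +-congˡ (trans (*-congˡ (trans (*-comm _ _) (pow-inverse (k ℕ.* p) (γᵢ≉0 i)))) (*-identityʳ _)) ⟩
    - (γᵏ * c i) + γᵏ * (ρ k * c (next i 1))
      ≈⟨ solve 3 (λ g x y → :- (g :* x) :+ g :* y := g :* (:- x :+ y)) refl γᵏ (c i) _ ⟩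
    γᵏ * Δ (ρ k) c i ∎
    where
    k  = suc n
    β  = γᵢ i
    γᵏ = scale k i
    βᵖᵏ≈βᵏᵖ : pow (pow β (p ^ 1)) k ≈ pow β (k ℕ.* p)
    βᵖᵏ≈βᵏᵖ = trans (sym (pow-* β (p ^ 1) k)) (reflexive (≡.cong (pow β) (≡.trans (≡.cong (ℕ._* k) (ℕP.*-identityʳ p)) (ℕP.*-comm p k))))

  diag-unscale : ∀ n x i → diag n x i ≈ scale (suc n) i * Δ (ρ (suc n)) (λ j → unscale (suc n) j * x j) i
  diag-unscale n x i = trans (diag-cong n (scale-unscale (suc n) x) i) (diag-scale n (λ j → unscale (suc n) j * x j) i)

  1-ρ^e≉0 : ∀ k → lam ≢ + k → ¬ (1# - pow (ρ k) e) ≈ 0#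
  1-ρ^e≉0 k lam≢k 1-ρᵉ≈0 = P^[μ-k]e≉1 e lam k lam≢k (sym (x∙y⁻¹≈ε⇒x≈y _ _ 1-ρᵉ≈0))

  ρ-at-λ : ∀ k → lam ≡ + k → ρ k ≈ 1#
  ρ-at-λ k ≡.refl = pow-inverse k P≉0

  diag-injective : ∀ n → lam ≢ + suc n → ∀ x → (∀ i → diag n x i ≈ 0#) → ∀ i → x i ≈ 0#
  diag-injective n lam≢k x diag≈0 i = begin
    x i                                   ≈⟨ scale-unscale k x i ⟩
    scale k i * (unscale k i * x i)       ≈⟨ *-congˡ (Δ-injective (ρ k) _ (1-ρ^e≉0 k lam≢k)
                                               (λ j → *-cancelˡ-≈0 (scale≉0 k j) (trans (sym (diag-unscale n x j)) (diag≈0 j))) i) ⟩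
    scale k i * 0#                        ≈⟨ zeroʳ _ ⟩
    0#                                    ∎
    where k = suc n

  diag-surjective : ∀ n → lam ≢ + suc n → ∀ z → Σ (Fin e → Carrier) λ x → ∀ i → diag n x i ≈ z i
  diag-surjective n lam≢k z = (λ i → scale k i * x̃ i) , λ i → begin
    diag n (λ j → scale k j * x̃ j) i        ≈⟨ diag-scale n x̃ i ⟩
    scale k i * Δ (ρ k) x̃ i                 ≈⟨ *-congˡ (Δ-Δ⁻¹ (ρ k) (λ j → unscale k j * z j) (1-ρ^e≉0 k lam≢k) i) ⟩
    scale k i * (unscale k i * z i)         ≈⟨ scale-unscale k z i ⟨
    z i                                     ∎
    where
    k = suc n
    x̃ = Δ⁻¹ (ρ k) (λ i → unscale k i * z i)

  diag-scale-at-λ : ∀ n → lam ≡ + suc n → ∀ u i → diag n (λ j → scale (suc n) j * u j) i ≈ scale (suc n) i * Δ 1# u i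
  diag-scale-at-λ n lam≡k u i = trans (diag-scale n u i) (*-congˡ (+-congˡ (*-congʳ (ρ-at-λ (suc n) lam≡k))))

  diag-unscale-at-λ : ∀ n → lam ≡ + suc n → ∀ x i → diag n x i ≈ scale (suc n) i * Δ 1# (λ j → unscale (suc n) j * x j) i
  diag-unscale-at-λ n lam≡k x i = trans (diag-cong n (scale-unscale (suc n) x) i) (diag-scale-at-λ n lam≡k (λ j → unscale (suc n) j * x j) i)

  diag-solve-at-λ : ∀ n → lam ≡ + suc n → ∀ z →
    Σ Carrier λ a → Σ (Fin e → Carrier) λ x → ∀ i → diag n x i + a * scale (suc n) i ≈ z i
  diag-solve-at-λ n lam≡k z = mean z′ , (λ i → scale k i * x̃ i) , λ i → begin
    diag n (λ j → scale k j * x̃ j) i + mean z′ * scale k i   ≈⟨ +-cong (diag-scale-at-λ n lam≡k x̃ i) (*-comm _ _) ⟩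
    scale k i * Δ 1# x̃ i + scale k i * mean z′              ≈⟨ distribˡ _ _ _ ⟨
    scale k i * (Δ 1# x̃ i + mean z′)                        ≈⟨ *-congˡ (Δ₁-section-correct z′ i) ⟩
    scale k i * (unscale k i * z i)                         ≈⟨ scale-unscale k z i ⟨
    z i                                                     ∎
    where
    k = suc n
    z′ : Fin e → Carrier
    z′ i = unscale k i * z i
    x̃ = Δ₁-section z′

  diag-kernel-at-λ : ∀ n → lam ≡ + suc n → ∀ x → (∀ i → diag n x i ≈ 0#) →
    ∀ i → x i ≈ (unscale (suc n) i₀ * x i₀) * scale (suc n) i
  diag-kernel-at-λ n lam≡k x diag≈0 i = begin
    x i                                  ≈⟨ scale-unscale k x i ⟩
    scale k i * x̃ i                      ≈⟨ *-congˡ (Δ₁-kernel x̃ (λ j → *-cancelˡ-≈0 (scale≉0 k j)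
                                              (trans (sym (diag-unscale-at-λ n lam≡k x j)) (diag≈0 j))) i) ⟩
    scale k i * x̃ i₀                     ≈⟨ *-comm _ _ ⟩
    x̃ i₀ * scale k i                     ∎
    where
    k = suc n
    x̃ : Fin e → Carrier
    x̃ i = unscale k i * x i

  scale∉image-diag : ∀ n → lam ≡ + suc n → ∀ x → ¬ (∀ i → diag n x i ≈ scale (suc n) i)
  scale∉image-diag n lam≡k x diag≈scale = 1∉image-Δ₁ x̃ (λ j → *-cancelˡ-≈ (scale≉0 k j) (begin
    scale k j * Δ 1# x̃ j      ≈⟨ diag-unscale-at-λ n lam≡k x j ⟨
    diag n x j                ≈⟨ diag≈scale j ⟩
    scale k j                 ≈⟨ *-identityʳ _ ⟨
    scale k j * 1#            ∎))
    where
    k = suc n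
    x̃ : Fin e → Carrier
    x̃ i = unscale k i * x i

module TriangularSystem {c ℓ} (F : ACField c ℓ) (p : ℕ) (2≤p : 2 ≤ p) (e : ℕ) .{{_ : NonZero e}}
  (γ : Mahler.Carrier F p) (γ≉0 : ¬ Mahler._≈_ F p γ (Mahler.0# F p))
  (γ-periodic : Mahler._≈_ F p (Mahler.pow F p γ (p ^ e)) γ) (lam : ℤ) where
  open DiagonalBlock F p 2≤p e γ γ≉0 γ-periodic lam public
  open Mahler F p using (V)
  open Mahler.Cycle F p e γ public using (Elt; D; vec; bound; supp; _≋_)

  Seq : Set c
  Seq = Fin e → ℕ → Carrier

  VanishesFrom : ℕ → Seq → Set ℓ
  VanishesFrom S f = ∀ i m → S ≤ m → f i m ≈ 0#

  -- The cycle map with its inner sum cut off at N; D lam d is Dtrunc (bound d) (vec d).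
  Dtrunc : ℕ → Seq → Fin e → ℕ → Carrier
  Dtrunc N f i n = - f i n + Pλ * sumTo (N ℕ.∸ n) (λ j → V (suc (n ℕ.+ j)) (suc n) (γᵢ i) * f (next i 1) (n ℕ.+ j))

  Dtrunc-extend : ∀ B N f → VanishesFrom B f → B ≤ N → ∀ i n → Dtrunc B f i n ≈ Dtrunc N f i n
  Dtrunc-extend B N f f≈0 B≤N i n = +-congˡ (*-congˡ (sumTo-extend (B ℕ.∸ n) (N ℕ.∸ n) (ℕP.∸-monoˡ-≤ n B≤N)
    (λ j B∸n≤j → trans (*-congˡ (f≈0 _ _ (ℕP.≤-trans (ℕP.m≤n+m∸n B n) (ℕP.+-monoʳ-≤ n B∸n≤j)))) (zeroʳ _))))

  Dtrunc-cong : ∀ N f g → (∀ i m → f i m ≈ g i m) → ∀ i n → Dtrunc N f i n ≈ Dtrunc N g i n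
  Dtrunc-cong N f g f≈g i n = +-cong (-‿cong (f≈g i n)) (*-congˡ (sumTo-cong (N ℕ.∸ n) (λ j _ → *-congˡ (f≈g _ _))))

  Dtrunc-linear : ∀ N a b f g i n →
    Dtrunc N (λ i m → a * f i m + b * g i m) i n ≈ a * Dtrunc N f i n + b * Dtrunc N g i n
  Dtrunc-linear N a b f g i n = begin
    - (a * f i n + b * g i n) + Pλ * sumTo (N ℕ.∸ n) (λ j → v j * (a * f′ j + b * g′ j))
      ≈⟨ +-congˡ (*-congˡ (trans (sumTo-cong (N ℕ.∸ n) (λ j _ →
           solve 5 (λ v a b x y → v :* (a :* x :+ b :* y) := a :* (v :* x) :+ b :* (v :* y)) refl (v j) a b (f′ j) (g′ j)))
           (trans (sumTo-+ (N ℕ.∸ n) _ _) (sym (+-cong (*-distribˡ-sumTo (N ℕ.∸ n) a _) (*-distribˡ-sumTo (N ℕ.∸ n) b _)))))) ⟩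
    - (a * f i n + b * g i n) + Pλ * (a * SF + b * SG)
      ≈⟨ solve 7 (λ a b x y r s t → :- (a :* x :+ b :* y) :+ r :* (a :* s :+ b :* t) := a :* (:- x :+ r :* s) :+ b :* (:- y :+ r :* t))
           refl a b (f i n) (g i n) Pλ SF SG ⟩
    a * Dtrunc N f i n + b * Dtrunc N g i n ∎
    where
    v : ℕ → Carrier
    v j = V (suc (n ℕ.+ j)) (suc n) (γᵢ i)
    f′ g′ : ℕ → Carrier
    f′ j = f (next i 1) (n ℕ.+ j)
    g′ j = g (next i 1) (n ℕ.+ j)
    SF = sumTo (N ℕ.∸ n) (λ j → v j * f′ j)
    SG = sumTo (N ℕ.∸ n) (λ j → v j * g′ j)

  Dtrunc-vanishesFrom : ∀ N f S → VanishesFrom S f → VanishesFrom S (Dtrunc N f)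
  Dtrunc-vanishesFrom N f S f≈0 i n S≤n = begin
    - f i n + Pλ * sumTo (N ℕ.∸ n) (λ j → V (suc (n ℕ.+ j)) (suc n) (γᵢ i) * f (next i 1) (n ℕ.+ j))
      ≈⟨ +-cong (-‿cong (f≈0 i n S≤n)) (*-congˡ (sumTo-zero (N ℕ.∸ n) (λ j _ →
           trans (*-congˡ (f≈0 _ _ (ℕP.≤-trans S≤n (ℕP.m≤m+n n j)))) (zeroʳ _)))) ⟩
    - 0# + Pλ * 0#   ≈⟨ +-cong -0#≈0# (zeroʳ _) ⟩
    0# + 0#          ≈⟨ +-identityʳ _ ⟩
    0#               ∎

  -- At the top level only the s = k term of the sum survives.
  Dtrunc-top : ∀ N f n → VanishesFrom (suc n) f → suc n ≤ N → ∀ i → Dtrunc N f i n ≈ diag n (λ j → f j n) i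
  Dtrunc-top N f n f≈0 n<N i = +-congˡ (*-congˡ (begin
    sumTo (N ℕ.∸ n) h                             ≡⟨ ≡.cong (λ m → sumTo m h) (ℕP.+-∸-assoc 1 n<N) ⟩
    sumTo (suc (N ℕ.∸ suc n)) h                   ≈⟨ sumTo-head (N ℕ.∸ suc n) h ⟩
    h 0 + sumTo (N ℕ.∸ suc n) (λ j → h (suc j))   ≈⟨ +-congˡ (sumTo-zero (N ℕ.∸ suc n) (λ j _ →
                                                       trans (*-congˡ (f≈0 _ _ (ℕP.≤-trans (s≤s (ℕP.m≤m+n n j)) (ℕP.≤-reflexive (≡.sym (ℕP.+-suc n j)))))) (zeroʳ _))) ⟩
    h 0 + 0#                                      ≈⟨ +-identityʳ _ ⟩
    h 0                                           ≡⟨ ≡.cong (λ m → V (suc m) (suc n) (γᵢ i) * f (next i 1) m) (ℕP.+-identityʳ n) ⟩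
    V (suc n) (suc n) (γᵢ i) * f (next i 1) n     ∎))
    where
    h : ℕ → Carrier
    h j = V (suc (n ℕ.+ j)) (suc n) (γᵢ i) * f (next i 1) (n ℕ.+ j)

  vanishesFrom-mono : ∀ {S S′} f → S ≤ S′ → VanishesFrom S f → VanishesFrom S′ f
  vanishesFrom-mono f S≤S′ f≈0 i m S′≤m = f≈0 i m (ℕP.≤-trans S≤S′ S′≤m)

  vanishesFrom-pred : ∀ T f → VanishesFrom (suc T) f → (∀ i → f i T ≈ 0#) → VanishesFrom T f
  vanishesFrom-pred T f f≈0 fT≈0 i m T≤m with ℕP.m≤n⇒m<n∨m≡n T≤m
  ... | inj₁ T<m    = f≈0 i m T<m
  ... | inj₂ ≡.refl = fT≈0 i

  mkElt : (f : Seq) (B : ℕ) → VanishesFrom B f → Elt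
  mkElt f B f≈0 = record { vec = f ; bound = B ; supp = f≈0 }

  0ᴱ : Elt
  0ᴱ = mkElt (λ _ _ → 0#) 0 (λ _ _ _ → refl)

  lincomb : Carrier → Elt → Carrier → Elt → Elt
  lincomb a d b d′ = mkElt (λ i n → a * vec d i n + b * vec d′ i n) (bound d ⊔ bound d′) (λ i n B≤n →
    trans (+-cong (*-congˡ (supp d  i n (ℕP.≤-trans (ℕP.m≤m⊔n _ _) B≤n)))
                  (*-congˡ (supp d′ i n (ℕP.≤-trans (ℕP.m≤n⊔m _ _) B≤n))))
          (trans (+-cong (zeroʳ _) (zeroʳ _)) (+-identityʳ _)))

  atLevel′ : ℕ → (Fin e → Carrier) → Seq
  atLevel′ T x i n with n ℕ.≟ T
  ... | yes _ = x i
  ... | no  _ = 0#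

  atLevel′-at : ∀ T x i → atLevel′ T x i T ≈ x i
  atLevel′-at T x i with T ℕ.≟ T
  ... | yes _ = refl
  ... | no T≢T = ⊥-elim (T≢T ≡.refl)

  atLevel′-off : ∀ T x i n → n ≢ T → atLevel′ T x i n ≈ 0#
  atLevel′-off T x i n n≢T with n ℕ.≟ T
  ... | yes n≡T = ⊥-elim (n≢T n≡T)
  ... | no  _   = refl

  atLevel′-vanishesFrom : ∀ T x → VanishesFrom (suc T) (atLevel′ T x)
  atLevel′-vanishesFrom T x i n T<n = atLevel′-off T x i n (λ n≡T → ℕP.<-irrefl (≡.sym n≡T) T<n)

  atLevel : ℕ → (Fin e → Carrier) → Elt
  atLevel T x = mkElt (atLevel′ T x) (suc T) (atLevel′-vanishesFrom T x)

  D-Dtrunc : ∀ d N → bound d ≤ N → ∀ i n → D lam d i n ≈ Dtrunc N (vec d) i n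
  D-Dtrunc d N = Dtrunc-extend (bound d) N (vec d) (supp d)

  D-vanishesFrom : ∀ d → VanishesFrom (bound d) (D lam d)
  D-vanishesFrom d = Dtrunc-vanishesFrom (bound d) (vec d) (bound d) (supp d)

  D-lincomb : ∀ a d b d′ i n → D lam (lincomb a d b d′) i n ≈ a * D lam d i n + b * D lam d′ i n
  D-lincomb a d b d′ i n = trans (Dtrunc-linear N a b (vec d) (vec d′) i n)
    (sym (+-cong (*-congˡ (D-Dtrunc d N (ℕP.m≤m⊔n _ _) i n)) (*-congˡ (D-Dtrunc d′ N (ℕP.m≤n⊔m _ _) i n))))
    where N = bound d ⊔ bound d′

  D-top : ∀ d n → VanishesFrom (suc n) (vec d) → ∀ i → D lam d i n ≈ diag n (λ j → vec d j n) i
  D-top d n d≈0 i = trans (D-Dtrunc d (bound d ⊔ suc n) (ℕP.m≤m⊔n _ _) i n)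
                          (Dtrunc-top _ (vec d) n d≈0 (ℕP.m≤n⊔m _ _) i)

  D-atLevel : ∀ T x i → D lam (atLevel T x) i T ≈ diag T x i
  D-atLevel T x i = trans (D-top (atLevel T x) T (atLevel′-vanishesFrom T x) i) (diag-cong T (atLevel′-at T x) i)

  -- Descending induction on the top level, using that diag is injective off resonance.
  vanishesFrom-descend : ∀ T S (d : Elt) → VanishesFrom T (vec d) → VanishesFrom S (D lam d) →
    (∀ n → S ≤ n → n < T → lam ≢ + suc n) → VanishesFrom S (vec d)
  vanishesFrom-descend zero    S d d≈0 Dd≈0 nonres = vanishesFrom-mono (vec d) z≤n d≈0
  vanishesFrom-descend (suc T) S d d≈0 Dd≈0 nonres with S ℕ.≤? T
  ... | no  S≰T = vanishesFrom-mono (vec d) (ℕP.≰⇒> S≰T) d≈0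
  ... | yes S≤T = vanishesFrom-descend T S d (vanishesFrom-pred T (vec d) d≈0 dT≈0) Dd≈0
                    (λ n S≤n n<T → nonres n S≤n (ℕP.m<n⇒m<1+n n<T))
    where
    dT≈0 : ∀ i → vec d i T ≈ 0#
    dT≈0 = diag-injective T (nonres T S≤T ℕP.≤-refl) (λ i → vec d i T)
             (λ i → trans (sym (D-top d T d≈0 i)) (Dd≈0 i T S≤T))

  LevelSolution : Elt → ℕ → (Fin e → Carrier) → Set (c Level.⊔ ℓ)
  LevelSolution v T z = Σ Carrier λ a → Σ (Fin e → Carrier) λ x →
    (∀ i → diag T x i + a * vec v i T ≈ z i) × VanishesFrom (suc T) (λ i m → a * vec v i m)

  LevelwiseSolvable : Elt → Set (c Level.⊔ ℓ)
  LevelwiseSolvable v = ∀ T z → LevelSolution v T z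

  nonresonantSolution : ∀ v T z → lam ≢ + suc T → LevelSolution v T z
  nonresonantSolution v T z nonres =
    0# , x , (λ i → trans (+-congˡ (zeroˡ _)) (trans (+-identityʳ _) (diag≈z i))) , λ _ _ _ → zeroˡ _
    where
    x = proj₁ (diag-surjective T nonres z)
    diag≈z = proj₂ (diag-surjective T nonres z)

  residual : Elt → Elt → Carrier → Elt → Elt
  residual y s a v = mkElt (λ i n → vec y i n - D lam s i n - a * vec v i n) (bound y ⊔ bound s ⊔ bound v) (λ i n B≤n →
    begin
      vec y i n - D lam s i n - a * vec v i n
        ≈⟨ +-cong (+-cong (supp y i n (ℕP.≤-trans (ℕP.≤-trans (ℕP.m≤m⊔n _ _) (ℕP.m≤m⊔n _ _)) B≤n))
                          (-‿cong (D-vanishesFrom s i n (ℕP.≤-trans (ℕP.≤-trans (ℕP.m≤n⊔m (bound y) _) (ℕP.m≤m⊔n _ _)) B≤n))))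
                  (-‿cong (trans (*-congˡ (supp v i n (ℕP.≤-trans (ℕP.m≤n⊔m _ _) B≤n))) (zeroʳ _))) ⟩
      0# - 0# - 0#  ≈⟨ trans (+-cong (-‿inverseʳ 0#) -0#≈0#) (+-identityʳ _) ⟩
      0#            ∎)

  residual-lowers : ∀ v T (y : Elt) → VanishesFrom (suc T) (vec y) → ∀ a x →
    (∀ i → diag T x i + a * vec v i T ≈ vec y i T) → VanishesFrom (suc T) (λ i m → a * vec v i m) →
    VanishesFrom T (vec (residual y (atLevel T x) a v))
  residual-lowers v T y y≈0 a x solves av≈0 = vanishesFrom-pred T _ above top
    where
    above : VanishesFrom (suc T) (vec (residual y (atLevel T x) a v))
    above i m T<m = begin
      vec y i m - D lam (atLevel T x) i m - a * vec v i m
        ≈⟨ +-cong (+-cong (y≈0 i m T<m) (-‿cong (D-vanishesFrom (atLevel T x) i m T<m))) (-‿cong (av≈0 i m T<m)) ⟩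
      0# - 0# - 0#  ≈⟨ trans (+-cong (-‿inverseʳ 0#) -0#≈0#) (+-identityʳ _) ⟩
      0#            ∎
    top : ∀ i → vec (residual y (atLevel T x) a v) i T ≈ 0#
    top i = begin
      vec y i T - D lam (atLevel T x) i T - a * vec v i T  ≈⟨ +-congʳ (+-congˡ (-‿cong (D-atLevel T x i))) ⟩
      vec y i T - diag T x i - a * vec v i T              ≈⟨ solve 3 (λ y d a → y :- d :- a := y :- (d :+ a)) refl (vec y i T) (diag T x i) (a * vec v i T) ⟩
      vec y i T - (diag T x i + a * vec v i T)            ≈⟨ +-congˡ (-‿cong (solves i)) ⟩
      vec y i T - vec y i T                               ≈⟨ -‿inverseʳ _ ⟩
      0#                                                  ∎

  solve-modulo : (v : Elt) → LevelwiseSolvable v → ∀ T (y : Elt) → VanishesFrom T (vec y) →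
    Σ Carrier λ a → Σ Elt λ d → ∀ i n → vec y i n ≈ D lam d i n + a * vec v i n
  solve-modulo v solvable zero y y≈0 = 0# , 0ᴱ , λ i n → begin
    vec y i n                   ≈⟨ y≈0 i n z≤n ⟩
    0#                          ≈⟨ trans (+-identityʳ _) (D-vanishesFrom 0ᴱ i n z≤n) ⟨
    D lam 0ᴱ i n + 0#           ≈⟨ +-congˡ (zeroˡ _) ⟨
    D lam 0ᴱ i n + 0# * vec v i n ∎
  solve-modulo v solvable (suc T) y y≈0 with solvable T (λ i → vec y i T)
  ... | a , x , solves , av≈0 with solve-modulo v solvable T (residual y (atLevel T x) a v) (residual-lowers v T y y≈0 a x solves av≈0)
  ... | a′ , d′ , y′≈ = a + a′ , lincomb 1# s 1# d′ , λ i n → begin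
    vec y i n
      ≈⟨ solve 3 (λ y t u → y := ((y :- t) :- u) :+ (t :+ u)) refl (vec y i n) (D lam s i n) (a * vec v i n) ⟩
    vec (residual y s a v) i n + (D lam s i n + a * vec v i n)
      ≈⟨ +-congʳ (y′≈ i n) ⟩
    (D lam d′ i n + a′ * vec v i n) + (D lam s i n + a * vec v i n)
      ≈⟨ solve 5 (λ d t a′ a w → (d :+ a′ :* w) :+ (t :+ a :* w) := (t :+ d) :+ (a :+ a′) :* w) refl (D lam d′ i n) (D lam s i n) a′ a (vec v i n) ⟩
    (D lam s i n + D lam d′ i n) + (a + a′) * vec v i n
      ≈⟨ +-congʳ (trans (D-lincomb 1# s 1# d′ i n) (+-cong (*-identityˡ _) (*-identityˡ _))) ⟨
    D lam (lincomb 1# s 1# d′) i n + (a + a′) * vec v i n ∎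
    where s = atLevel T x

module KernelVector {c ℓ} (F : ACField c ℓ) (p : ℕ) (2≤p : 2 ≤ p) (e : ℕ) .{{_ : NonZero e}}
  (γ : Mahler.Carrier F p) (γ≉0 : ¬ Mahler._≈_ F p γ (Mahler.0# F p))
  (γ-periodic : Mahler._≈_ F p (Mahler.pow F p γ (p ^ e)) γ) (l : ℕ) where
  open TriangularSystem F p 2≤p e γ γ≉0 γ-periodic (+ l) public
  open Mahler F p using (_⁻¹; P; zpow; V; 𝕍)
  open Mahler.Cycle F p e γ using (nth; zeroF)
  open Mahler.Cycle.W F p e γ l using (w; wTab; wnew)

  nth-wTab-beyond : ∀ t n → t < n → nth zeroF (wTab t) n ≡ zeroF
  nth-wTab-beyond zero    (suc n) _         = ≡.refl
  nth-wTab-beyond (suc t) (suc n) (s≤s t<n) = nth-wTab-beyond t n t<n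

  nth-wTab-top : ∀ t → nth zeroF (wTab t) t ≡ scale l
  nth-wTab-top zero    = ≡.refl
  nth-wTab-top (suc t) = nth-wTab-top t

  nth-wTab-shift : ∀ a t q → nth zeroF (wTab (a ℕ.+ t)) (a ℕ.+ q) ≡ nth zeroF (wTab t) q
  nth-wTab-shift zero    t q = ≡.refl
  nth-wTab-shift (suc a) t q = nth-wTab-shift a t q

  w-vanishesFrom : ∀ n₀ → l ≡ suc n₀ → VanishesFrom l w
  w-vanishesFrom n₀ ≡.refl i n l≤n = reflexive (≡.cong (λ f → f i) (nth-wTab-beyond n₀ n l≤n))

  w-top : ∀ n₀ → l ≡ suc n₀ → ∀ i → w i n₀ ≈ scale l i
  w-top n₀ ≡.refl i = reflexive (≡.cong (λ f → f i) (nth-wTab-top n₀))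


  module _ (n t : ℕ) where
    private
      k m : ℕ
      k = suc n
      m = suc t
      s : ℕ → ℕ
      s q = suc (k ℕ.+ q)

    W : ℕ → Fin e → Carrier
    W q = nth zeroF (wTab t) q

    w-at : l ≡ k ℕ.+ m → ∀ j → w j n ≈ wnew k (wTab t) j
    w-at ≡.refl j = begin
      nth zeroF (wTab (n ℕ.+ m)) n j                   ≡⟨ ≡.cong (λ r → nth zeroF (wTab (n ℕ.+ m)) r j) (ℕP.+-identityʳ n) ⟨
      nth zeroF (wTab (n ℕ.+ m)) (n ℕ.+ 0) j           ≡⟨ ≡.cong (λ f → f j) (nth-wTab-shift n m 0) ⟩
      wnew (k ℕ.+ m ℕ.∸ m) (wTab t) j                 ≡⟨ ≡.cong (λ r → wnew r (wTab t) j) (ℕP.m+n∸n≡m k m) ⟩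
      wnew k (wTab t) j                               ∎

    w-above : l ≡ k ℕ.+ m → ∀ q j → w j (n ℕ.+ suc q) ≈ W q j
    w-above ≡.refl q j = reflexive (≡.cong (λ f → f j) (nth-wTab-shift n m (suc q)))

    -- The higher levels enter level k through this vector.
    B : Fin e → Carrier
    B j = sumTo m (λ q → 𝕍 (s q) k * pow (γᵢ j ⁻¹) (s q ℕ.* p) * W q (next j 1))

    ρ≈P^m : l ≡ k ℕ.+ m → ρ k ≈ pow P m
    ρ≈P^m ≡.refl = begin
      pow P (k ℕ.+ m) * pow (P ⁻¹) k     ≡⟨ ≡.cong (λ r → pow P r * pow (P ⁻¹) k) (ℕP.+-comm k m) ⟩
      pow P (m ℕ.+ k) * pow (P ⁻¹) k     ≈⟨ *-congʳ (pow-+ P m k) ⟩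
      (pow P m * pow P k) * pow (P ⁻¹) k ≈⟨ *-assoc _ _ _ ⟩
      pow P m * (pow P k * pow (P ⁻¹) k) ≈⟨ *-congˡ (pow-inverse k P≉0) ⟩
      pow P m * 1#                       ≈⟨ *-identityʳ _ ⟩
      pow P m                            ∎

    higher-levels : l ≡ k ℕ.+ m → ∀ i →
      Pλ * sumTo m (λ q → V (s q) k (γᵢ i) * W q (next i 1)) ≈ scale k i * (pow P l * B i)
    higher-levels l≡k+m i = begin
      Pλ * sumTo m (λ q → V (s q) k (γᵢ i) * W q (next i 1))
        ≈⟨ *-distribˡ-sumTo m Pλ _ ⟩
      sumTo m (λ q → Pλ * (V (s q) k (γᵢ i) * W q (next i 1)))
        ≈⟨ sumTo-cong m (λ q _ → trans (*-congˡ (*-congʳ (*-congˡ (zpow-+- (γᵢ i) k (s q ℕ.* p) (γᵢ≉0 i)))))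
             (solve 5 (λ r v g y x → r :* ((v :* (g :* y)) :* x) := g :* (r :* ((v :* y) :* x))) refl Pλ _ _ _ _)) ⟩
      sumTo m (λ q → scale k i * (pow P l * (𝕍 (s q) k * pow (γᵢ i ⁻¹) (s q ℕ.* p) * W q (next i 1))))
        ≈⟨ *-distribˡ-sumTo m (scale k i) _ ⟨
      scale k i * sumTo m (λ q → pow P l * (𝕍 (s q) k * pow (γᵢ i ⁻¹) (s q ℕ.* p) * W q (next i 1)))
        ≈⟨ *-congˡ (*-distribˡ-sumTo m (pow P l) _) ⟨
      scale k i * (pow P l * B i) ∎

    λ≢k : l ≡ k ℕ.+ m → + l ≢ + k
    λ≢k ≡.refl l≡k = ℕP.1+n≢0 (ℕP.+-cancelˡ-≡ k m 0 (≡.trans (ℤP.+-injective l≡k) (≡.sym (ℕP.+-identityʳ k))))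

    levelRhs : Fin e → Carrier
    levelRhs j = - (pow P l * B j)

    -- Reindexing the double sum defining w_k via γ^{-s p^{j+1}} = γ_{j}^{-sp}
    -- and p^{(λ-k)j} = ρ^j exhibits w_k as a solution of the level-k equation.
    wnew-Δ⁻¹ : l ≡ k ℕ.+ m → ∀ j → wnew k (wTab t) j ≈ scale k j * Δ⁻¹ (ρ k) levelRhs j
    wnew-Δ⁻¹ l≡k+m@≡.refl j = begin
      wnew k (wTab t) j
        ≡⟨ ≡.cong (λ r → (pow P l * scale k j * (1# - pow P (r ℕ.* e)) ⁻¹) * sumTo e (λ j′ → sumTo r (λ q → summand r j′ q)))
                  (ℕP.m+n∸m≡n n m) ⟩
      (pow P l * scale k j * (1# - pow P (m ℕ.* e)) ⁻¹) * sumTo e (λ j′ → sumTo m (λ q → summand m j′ q))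
        ≈⟨ *-cong (*-congˡ (⁻¹-cong 1-Pᵐᵉ≈1-ρᵉ (λ 1-Pᵐᵉ≈0 → 1-ρᵉ≉0 (trans (sym 1-Pᵐᵉ≈1-ρᵉ) 1-Pᵐᵉ≈0))))
                  (sumTo-cong e (λ j′ _ → reindex j′)) ⟩
      (pow P l * scale k j * u ⁻¹) * orbitSum (ρ k) B j
        ≈⟨ solve 4 (λ a g v x → (a :* g :* v) :* x := g :* (:- v :* (:- a :* x))) refl (pow P l) (scale k j) (u ⁻¹) _ ⟩
      scale k j * (- (u ⁻¹) * (- pow P l * orbitSum (ρ k) B j))
        ≈⟨ *-congˡ (*-congˡ (trans (*-distribˡ-sumTo e _ _) (sumTo-cong e (λ j′ _ →
             solve 3 (λ a x b → :- a :* (x :* b) := x :* (:- (a :* b))) refl (pow P l) _ _)))) ⟩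
      scale k j * Δ⁻¹ (ρ k) levelRhs j ∎
      where
      u = 1# - pow (ρ k) e
      1-ρᵉ≉0 = 1-ρ^e≉0 k (λ≢k l≡k+m)
      1-Pᵐᵉ≈1-ρᵉ : 1# - pow P (m ℕ.* e) ≈ u
      1-Pᵐᵉ≈1-ρᵉ = +-congˡ (-‿cong (trans (pow-* P m e) (pow-cong e (sym (ρ≈P^m l≡k+m)))))
      summand : ℕ → ℕ → ℕ → Carrier
      summand r j′ q = pow P (r ℕ.* j′) * 𝕍 (s q) k * zpow (γᵢ j) (ℤ.- (+ (s q ℕ.* p ^ suc j′))) * W q (next j (suc j′))
      reindex : ∀ j′ → sumTo m (summand m j′) ≈ pow (ρ k) j′ * B (next j j′)
      reindex j′ = trans (sumTo-cong m (λ q _ → trans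
          (*-cong (*-cong (*-congʳ (trans (pow-* P m j′) (pow-cong j′ (sym (ρ≈P^m l≡k+m))))) (zpow-γᵢ-next (s q) j j′))
                  (reflexive (≡.cong (W q) (≡.sym (next-suc j j′)))))
          (solve 4 (λ a b c d → a :* b :* c :* d := a :* (b :* c :* d)) refl _ _ _ _)))
        (sym (*-distribˡ-sumTo m (pow (ρ k) j′) _))

    w-level : l ≡ k ℕ.+ m → ∀ i → Dtrunc l w i n ≈ 0#
    w-level l≡k+m@≡.refl i = begin
      - w i n + Pλ * sumTo (l ℕ.∸ n) H
        ≡⟨ ≡.cong (λ r → - w i n + Pλ * sumTo r H) (≡.trans (≡.cong (ℕ._∸ n) (≡.sym (ℕP.+-suc n m))) (ℕP.m+n∸m≡n n (suc m))) ⟩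
      - w i n + Pλ * sumTo (suc m) H
        ≈⟨ +-congˡ (*-congˡ (sumTo-head m H)) ⟩
      - w i n + Pλ * (H 0 + sumTo m (λ q → H (suc q)))
        ≈⟨ solve 4 (λ x r a b → :- x :+ r :* (a :+ b) := (:- x :+ r :* a) :+ r :* b) refl (w i n) Pλ (H 0) _ ⟩
      (- w i n + Pλ * H 0) + Pλ * sumTo m (λ q → H (suc q))
        ≈⟨ +-cong level-k (trans (*-congˡ (sumTo-cong m (λ q _ → H-above q))) (higher-levels l≡k+m i)) ⟩
      scale k i * levelRhs i + scale k i * (pow P l * B i)
        ≈⟨ solve 2 (λ g x → g :* (:- x) :+ g :* x := :- x :+ x) refl (scale k i) (pow P l * B i) ⟩
      - (pow P l * B i) + pow P l * B i
        ≈⟨ -‿inverseˡ _ ⟩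
      0# ∎
      where
      H : ℕ → Carrier
      H j = V (suc (n ℕ.+ j)) k (γᵢ i) * w (next i 1) (n ℕ.+ j)
      H-above : ∀ q → H (suc q) ≈ V (s q) k (γᵢ i) * W q (next i 1)
      H-above q = trans (reflexive (≡.cong (λ r → V (suc r) k (γᵢ i) * w (next i 1) (n ℕ.+ suc q)) (ℕP.+-suc n q)))
                        (*-congˡ (w-above l≡k+m q (next i 1)))
      level-k : - w i n + Pλ * H 0 ≈ scale k i * levelRhs i
      level-k = begin
        - w i n + Pλ * H 0
          ≡⟨ ≡.cong (λ r → - w i n + Pλ * (V (suc r) k (γᵢ i) * w (next i 1) r)) (ℕP.+-identityʳ n) ⟩
        diag n (λ j → w j n) i                                ≈⟨ diag-cong n (λ j → trans (w-at l≡k+m j) (wnew-Δ⁻¹ l≡k+m j)) i ⟩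
        diag n (λ j → scale k j * Δ⁻¹ (ρ k) levelRhs j) i ≈⟨ diag-scale n (Δ⁻¹ (ρ k) levelRhs) i ⟩
        scale k i * Δ (ρ k) (Δ⁻¹ (ρ k) levelRhs) i       ≈⟨ *-congˡ (Δ-Δ⁻¹ (ρ k) levelRhs (1-ρ^e≉0 k (λ≢k l≡k+m)) i) ⟩
        scale k i * levelRhs i                            ∎

  w-kernel : ∀ n₀ → l ≡ suc n₀ → ∀ i n → Dtrunc l w i n ≈ 0#
  w-kernel n₀ l≡1+n₀ i n with ℕP.<-cmp n n₀
  ... | tri< n<n₀ _ _ = w-level n (n₀ ℕ.∸ suc n)
          (≡.trans l≡1+n₀ (≡.cong suc (≡.sym (≡.trans (ℕP.+-suc n (n₀ ℕ.∸ suc n)) (ℕP.m+[n∸m]≡n n<n₀))))) i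
  ... | tri> _ _ n₀<n = Dtrunc-vanishesFrom l w l (w-vanishesFrom n₀ l≡1+n₀) i n (ℕP.≤-trans (ℕP.≤-reflexive l≡1+n₀) n₀<n)
  w-kernel n₀ ≡.refl i n | tri≈ _ ≡.refl _ = begin
    Dtrunc l w i n                       ≈⟨ Dtrunc-top l w n (w-vanishesFrom n ≡.refl) ℕP.≤-refl i ⟩
    diag n (λ j → w j n) i               ≈⟨ diag-cong n (λ j → trans (w-top n ≡.refl j) (sym (*-identityʳ _))) i ⟩
    diag n (λ j → scale l j * 1#) i      ≈⟨ diag-scale-at-λ n ≡.refl (λ _ → 1#) i ⟩
    scale l i * (- 1# + 1# * 1#)         ≈⟨ *-congˡ (trans (+-congˡ (*-identityʳ _)) (-‿inverseˡ _)) ⟩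
    scale l i * 0#                       ≈⟨ zeroʳ _ ⟩
    0#                                   ∎

module KernelAndImage {c ℓ} (F : ACField c ℓ) (p : ℕ) (2≤p : 2 ≤ p) (e : ℕ) .{{_ : NonZero e}}
  (γ : Mahler.Carrier F p) (γ≉0 : ¬ Mahler._≈_ F p γ (Mahler.0# F p))
  (γ-periodic : Mahler._≈_ F p (Mahler.pow F p γ (p ^ e)) γ) (lam : ℤ) where
  open TriangularSystem F p 2≤p e γ γ≉0 γ-periodic lam public

  kernel-vanishesFrom : ∀ S d → (∀ n → S ≤ n → lam ≢ + suc n) → (∀ i n → D lam d i n ≈ 0#) → VanishesFrom S (vec d)
  kernel-vanishesFrom S d nonres Dd≈0 = vanishesFrom-descend (bound d) S d (supp d) (λ i n _ → Dd≈0 i n) (λ n S≤n _ → nonres n S≤n)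

  D-difference : ∀ d d′ a i n → D lam (lincomb 1# d (- a) d′) i n ≈ D lam d i n - a * D lam d′ i n
  D-difference d d′ a i n = trans (D-lincomb 1# d (- a) d′ i n) (+-cong (*-identityˡ _) (sym (-‿distribˡ-* a _)))

  difference≈0 : ∀ d d′ a i n → vec (lincomb 1# d (- a) d′) i n ≈ 0# → vec d i n ≈ a * vec d′ i n
  difference≈0 d d′ a i n d-ad′≈0 = x∙y⁻¹≈ε⇒x≈y _ _
    (trans (+-cong (sym (*-identityˡ _)) (-‿distribˡ-* a _)) d-ad′≈0)

module NonPositiveWeight {c ℓ} (F : ACField c ℓ) (p : ℕ) (2≤p : 2 ≤ p) (e : ℕ) .{{_ : NonZero e}}
  (γ : Mahler.Carrier F p) (γ≉0 : ¬ Mahler._≈_ F p γ (Mahler.0# F p))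
  (γ-periodic : Mahler._≈_ F p (Mahler.pow F p γ (p ^ e)) γ) (lam : ℤ) (lam≤0 : lam ℤ.≤ + 0) where
  open KernelAndImage F p 2≤p e γ γ≉0 γ-periodic lam

  nonresonant : ∀ n → lam ≢ + suc n
  nonresonant n ≡.refl = ℕP.<-irrefl ≡.refl (ℕP.≤-trans (s≤s z≤n) (ℤP.drop‿+≤+ lam≤0))

  D-injective : ∀ (d d′ : Elt) → (∀ i n → D lam d i n ≈ D lam d′ i n) → d ≋ d′
  D-injective d d′ Dd≈Dd′ i n = trans (difference≈0 d d′ 1# i n (d-d′≈0 i n z≤n)) (*-identityˡ _)
    where
    d-d′ = lincomb 1# d (- 1#) d′
    Dd-Dd′≈0 : ∀ i n → D lam d-d′ i n ≈ 0#
    Dd-Dd′≈0 i n = begin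
      D lam d-d′ i n                ≈⟨ D-difference d d′ 1# i n ⟩
      D lam d i n - 1# * D lam d′ i n ≈⟨ +-congˡ (-‿cong (*-identityˡ _)) ⟩
      D lam d i n - D lam d′ i n     ≈⟨ x≈y⇒x∙y⁻¹≈ε (Dd≈Dd′ i n) ⟩
      0#                            ∎
    d-d′≈0 : VanishesFrom 0 (vec d-d′)
    d-d′≈0 = kernel-vanishesFrom 0 d-d′ (λ n _ → nonresonant n) Dd-Dd′≈0

  levelwiseSolvable : LevelwiseSolvable 0ᴱ
  levelwiseSolvable T z = nonresonantSolution 0ᴱ T z (nonresonant T)

  D-surjective : ∀ (y : Elt) → ∃ λ (d : Elt) → ∀ i n → D lam d i n ≈ vec y i n
  D-surjective y = proj₁ (proj₂ y≈Dd+a0) , λ i n → sym (trans (proj₂ (proj₂ y≈Dd+a0) i n) (trans (+-congˡ (zeroʳ _)) (+-identityʳ _)))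
    where y≈Dd+a0 = solve-modulo 0ᴱ levelwiseSolvable (bound y) y (supp y)

module PositiveWeight {c ℓ} (F : ACField c ℓ) (p : ℕ) (2≤p : 2 ≤ p) (e : ℕ) .{{_ : NonZero e}}
  (γ : Mahler.Carrier F p) (γ≉0 : ¬ Mahler._≈_ F p γ (Mahler.0# F p))
  (γ-periodic : Mahler._≈_ F p (Mahler.pow F p γ (p ^ e)) γ) (n₀ : ℕ) where
  l : ℕ
  l = suc n₀
  open KernelAndImage F p 2≤p e γ γ≉0 γ-periodic (+ l)
  open KernelVector F p 2≤p e γ γ≉0 γ-periodic l using (w-vanishesFrom; w-top; w-kernel)
  open Mahler.Cycle.W F p e γ l using (w)

  -- A complement of the image: γ^λ placed at the resonant level k = λ.
  v : Elt
  v = atLevel n₀ (scale l)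

  resonantSolution : ∀ z → LevelSolution v n₀ z
  resonantSolution z = a , x ,
    (λ i → trans (+-congˡ (*-congˡ (atLevel′-at n₀ (scale l) i))) (solves i)) ,
    λ i m n₀<m → trans (*-congˡ (atLevel′-vanishesFrom n₀ (scale l) i m n₀<m)) (zeroʳ _)
    where
    a = proj₁ (diag-solve-at-λ n₀ ≡.refl z)
    x = proj₁ (proj₂ (diag-solve-at-λ n₀ ≡.refl z))
    solves = proj₂ (proj₂ (diag-solve-at-λ n₀ ≡.refl z))

  levelwiseSolvable : LevelwiseSolvable v
  levelwiseSolvable T z = case T ℕ.≟ n₀ of λ where
    (yes ≡.refl) → resonantSolution z
    (no T≢n₀)    → nonresonantSolution v T z (λ l≡T+1 → T≢n₀ (ℕP.suc-injective (ℤP.+-injective (≡.sym l≡T+1))))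

  nonresonant-above : ∀ n → l ≤ n → + l ≢ + suc n
  nonresonant-above n l≤n l≡n+1 = ℕP.<-irrefl (ℕP.suc-injective (ℤP.+-injective l≡n+1)) l≤n

  v∉image : ¬ ∃ λ (d : Elt) → ∀ i n → D (+ l) d i n ≈ vec v i n
  v∉image (d , Dd≈v) = scale∉image-diag n₀ ≡.refl (λ i → vec d i n₀) (λ i → begin
    diag n₀ (λ j → vec d j n₀) i   ≈⟨ D-top d n₀ d<l i ⟨
    D (+ l) d i n₀                 ≈⟨ Dd≈v i n₀ ⟩
    vec v i n₀                     ≈⟨ atLevel′-at n₀ (scale l) i ⟩
    scale l i                      ∎)
    where
    d<l : VanishesFrom l (vec d)
    d<l = vanishesFrom-descend (bound d) l d (supp d)
            (λ i n l≤n → trans (Dd≈v i n) (atLevel′-vanishesFrom n₀ (scale l) i n l≤n)) (λ n l≤n _ → nonresonant-above n l≤n)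

  image⊕v : ∀ (y : Elt) → ∃ λ (a : Carrier) → ∃ λ (d : Elt) → ∀ i n → vec y i n ≈ D (+ l) d i n + a * vec v i n
  image⊕v y = solve-modulo v levelwiseSolvable (bound y) y (supp y)

  wᴱ : Elt
  wᴱ = mkElt w l (w-vanishesFrom n₀ ≡.refl)

  kernel⊆ : ∀ (d : Elt) → (∀ i n → D (+ l) d i n ≈ 0#) → ∃ λ (a : Carrier) → ∀ i n → vec d i n ≈ a * w i n
  kernel⊆ d Dd≈0 = a , λ i n → difference≈0 d wᴱ a i n (d-awᴱ≈0 i n z≤n)
    where
    d<l : VanishesFrom l (vec d)
    d<l = kernel-vanishesFrom l d nonresonant-above Dd≈0
    a = unscale l i₀ * vec d i₀ n₀
    dₙ₀≈a·scale : ∀ i → vec d i n₀ ≈ a * scale l i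
    dₙ₀≈a·scale = diag-kernel-at-λ n₀ ≡.refl (λ i → vec d i n₀) (λ i → trans (sym (D-top d n₀ d<l i)) (Dd≈0 i n₀))
    d-awᴱ = lincomb 1# d (- a) wᴱ
    d-awᴱ<l : VanishesFrom l (vec d-awᴱ)
    d-awᴱ<l i m l≤m = begin
      1# * vec d i m + - a * w i m   ≈⟨ +-cong (*-congˡ (d<l i m l≤m)) (*-congˡ (w-vanishesFrom n₀ ≡.refl i m l≤m)) ⟩
      1# * 0# + - a * 0#             ≈⟨ trans (+-cong (zeroʳ _) (zeroʳ _)) (+-identityʳ _) ⟩
      0#                             ∎
    d-awᴱ-at-λ : ∀ i → vec d-awᴱ i n₀ ≈ 0#
    d-awᴱ-at-λ i = begin
      1# * vec d i n₀ + - a * w i n₀    ≈⟨ +-cong (trans (*-identityˡ _) (dₙ₀≈a·scale i)) (*-congˡ (w-top n₀ ≡.refl i)) ⟩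
      a * scale l i + - a * scale l i   ≈⟨ +-congˡ (-‿distribˡ-* a _) ⟨
      a * scale l i - a * scale l i     ≈⟨ -‿inverseʳ _ ⟩
      0#                                ∎
    Dd-awᴱ≈0 : ∀ i n → D (+ l) d-awᴱ i n ≈ 0#
    Dd-awᴱ≈0 i n = begin
      D (+ l) d-awᴱ i n                    ≈⟨ D-difference d wᴱ a i n ⟩
      D (+ l) d i n - a * D (+ l) wᴱ i n   ≈⟨ +-cong (Dd≈0 i n) (-‿cong (trans (*-congˡ (w-kernel n₀ ≡.refl i n)) (zeroʳ _))) ⟩
      0# - 0#                              ≈⟨ -‿inverseʳ 0# ⟩
      0#                                   ∎
    d-awᴱ≈0 : VanishesFrom 0 (vec d-awᴱ)
    d-awᴱ≈0 = vanishesFrom-descend n₀ 0 d-awᴱ (vanishesFrom-pred n₀ _ d-awᴱ<l d-awᴱ-at-λ) (λ i n _ → Dd-awᴱ≈0 i n)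
                (λ n _ n<n₀ l≡n+1 → ℕP.<-irrefl (≡.sym (ℕP.suc-injective (ℤP.+-injective l≡n+1))) n<n₀)

  kernel⊇ : ∀ (d : Elt) → (∃ λ (a : Carrier) → ∀ i n → vec d i n ≈ a * w i n) → ∀ i n → D (+ l) d i n ≈ 0#
  kernel⊇ d (a , d≈aw) i n = begin
    D (+ l) d i n                              ≈⟨ D-Dtrunc d N (ℕP.m≤m⊔n _ _) i n ⟩
    Dtrunc N (vec d) i n                       ≈⟨ Dtrunc-cong N (vec d) (λ i m → a * w i m) d≈aw i n ⟩
    Dtrunc N (λ i m → a * w i m) i n           ≈⟨ Dtrunc-cong N _ (λ i m → a * w i m + 0# * w i m) (λ i m → sym (trans (+-congˡ (zeroˡ _)) (+-identityʳ _))) i n ⟩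
    Dtrunc N (λ i m → a * w i m + 0# * w i m) i n ≈⟨ Dtrunc-linear N a 0# w w i n ⟩
    a * Dtrunc N w i n + 0# * Dtrunc N w i n   ≈⟨ trans (+-congˡ (zeroˡ _)) (+-identityʳ _) ⟩
    a * Dtrunc N w i n                         ≈⟨ *-congˡ (Dtrunc-extend l N w (w-vanishesFrom n₀ ≡.refl) (ℕP.m≤n⊔m _ _) i n) ⟨
    a * Dtrunc l w i n                         ≈⟨ trans (*-congˡ (w-kernel n₀ ≡.refl i n)) (zeroʳ _) ⟩
    0#                                         ∎
    where N = bound d ⊔ l

D-isomorphism : ∀ {c ℓ : Level} (F : ACField c ℓ) (p : ℕ) → 2 ℕ.≤ p →
  let open Mahler F p in
  ∀ (γ : Carrier) → ¬ γ ≈ 0# → ∀ (e : ℕ) .{{_ : NonZero e}} → pow γ (p ^ e) ≈ γ →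
  let open Cycle e γ in
  ∀ (lam : ℤ) → lam ℤ.≤ + 0 →
    (∀ (d d′ : Elt) → (∀ i n → D lam d i n ≈ D lam d′ i n) → d ≋ d′)
    × (∀ (y : Elt) → ∃ λ (d : Elt) → ∀ i n → D lam d i n ≈ vec y i n)
D-isomorphism F p 2≤p γ γ≉0 e γ-periodic lam lam≤0 = D-injective , D-surjective
  where open NonPositiveWeight F p 2≤p e γ γ≉0 γ-periodic lam lam≤0

lemma3p4 : ∀ {c ℓ : Level} (F : ACField c ℓ) (p : ℕ) → 2 ℕ.≤ p →
    let open Mahler F p in
    ∀ (γ : Carrier) →
    (Σ ℕ λ n → n ≢ 0 × pow γ n ≈ 1# × Coprime n p) →
    ∀ (e : ℕ) .{{_ : NonZero e}} →
    pow γ (p ^ e) ≈ γ →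
    (∀ (i j : Fin e) → pow γ (p ^ toℕ i) ≈ pow γ (p ^ toℕ j) → i ≡ j) →
    let open Cycle e γ in
    ∀ (lam : ℤ) →
    (lam ℤ.≤ + 0 →
      (∀ (d d′ : Elt) → (∀ i n → D lam d i n ≈ D lam d′ i n) → d ≋ d′)
      × (∀ (y : Elt) → ∃ λ (d : Elt) → ∀ i n → D lam d i n ≈ vec y i n))
    ×
    (+ 1 ℤ.≤ lam →
      (∃ λ (v : Elt) →
          (¬ ∃ λ (d : Elt) → ∀ i n → D lam d i n ≈ vec v i n)
          × (∀ (y : Elt) → ∃ λ (a : Carrier) → ∃ λ (d : Elt) →
               ∀ i n → vec y i n ≈ D lam d i n + a * vec v i n))
      × (∀ (d : Elt) →
           ((∀ i n → D lam d i n ≈ 0#) → ∃ λ (a : Carrier) → ∀ i n → vec d i n ≈ a * W.w ∣ lam ∣ i n)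
           × ((∃ λ (a : Carrier) → ∀ i n → vec d i n ≈ a * W.w ∣ lam ∣ i n) → ∀ i n → D lam d i n ≈ 0#)))
lemma3p4 F p 2≤p γ (n , n≢0 , γⁿ≈1 , _) e γ-periodic _ (+ suc n₀) =
  D-isomorphism F p 2≤p γ γ≉0 e γ-periodic (+ suc n₀) ,
  λ _ → (v , v∉image , image⊕v) , λ d → kernel⊆ d , kernel⊇ d
  where
  γ≉0 = FieldLemmas.root-of-unity⇒≉0 F n n≢0 γⁿ≈1
  open PositiveWeight F p 2≤p e γ γ≉0 γ-periodic n₀
lemma3p4 F p 2≤p γ (n , n≢0 , γⁿ≈1 , _) e γ-periodic _ (+ zero) =
  D-isomorphism F p 2≤p γ (FieldLemmas.root-of-unity⇒≉0 F n n≢0 γⁿ≈1) e γ-periodic (+ zero) , λ { (ℤ.+≤+ ()) }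
lemma3p4 F p 2≤p γ (n , n≢0 , γⁿ≈1 , _) e γ-periodic _ -[1+ m ] =
  D-isomorphism F p 2≤p γ (FieldLemmas.root-of-unity⇒≉0 F n n≢0 γⁿ≈1) e γ-periodic -[1+ m ] , λ ()
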